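{- Let $n,r,k$ be positive integers with $N:=rn-k>0$. Let $a=(a_1,\dots,a_n)\in[N]^n$, and let $p\in[N]$ be the smallest positive integer $i$ such that the increasing rearrangements of $a$ and of $(a+i \bmod N)$ coincide; equivalently $p=\#R_N(a)$. Then the number of weakly increasing vectors $b\in S_n^{(r,k)}$ such that the increasing rearrangement of $(b\bmod N)$ lies in $R_N(a)$ equals $pk/N$.
   Context: $[m]=\{1,\dots,m\}$. For integers $s$ and $t>0$, $s\bmod t$ denotes the unique element of $[t]$ congruent to $s$ modulo $t$; for a vector $x=(x_1,\dots,x_n)$ and integer $i$, $x+i\bmod N:=(x_1+i\bmod N,\dots,x_n+i\bmod N)$ and $x\bmod N:=x+0\bmod N$. $R_N(a)$ is the set of increasing rearrangements of the vectors $(a+i\bmod N)$, $i\in\mathbb{Z}$. $S_n^{(r,k)}$ is the set of $n$-tuples of integers whose increasing rearrangement $(b_1,\dots,b_n)$ satisfies: (I) $b_1=w$ for some $w\in[k]$ and $b_n-b_1<rn-k$; (II) $b_{q(w)}=w$, where $q(w)$ is the smallest integer with $w\le q(w)r$; (III) $b_j\le(j-1)r$ for every $j\in[n]$ with $b_j>w$. -}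

module Defs where

open import Data.Nat as ℕ using (ℕ; zero; suc)
open import Data.Integer as ℤ using (ℤ; +_; _%ℕ_)
open import Data.Fin using (Fin; toℕ)
open import Data.Vec using (Vec; toList; lookup; map)
open import Data.List using (List)
open import Data.Product using (Σ; ∃; ∃-syntax; _×_)
open import Relation.Binary.PropositionalEquality using (_≡_)
open import Relation.Nullary using (¬_)
open import Data.List.Relation.Binary.Permutation.Propositional using (_↭_)
import Data.Integer.Properties as ℤP
open import Data.List.Relation.Unary.Sorted.TotalOrder ℤP.≤-totalOrder using (Sorted)

-- s mod t : the unique element of [t] = {1,…,t} congruent to s mod t (t > 0).
-- For t = 0 (never used) we return s.
_mod⁺_ : ℤ → ℕ → ℤ
s mod⁺ zero    = s
s mod⁺ (suc m) = + suc ((s ℤ.- ℤ.+ 1) %ℕ suc m)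

shiftMod : ∀ {n} → Vec ℤ n → ℤ → ℕ → Vec ℤ n
shiftMod x i N = map (λ xj → (xj ℤ.+ i) mod⁺ N) x

vecMod : ∀ {n} → Vec ℤ n → ℕ → Vec ℤ n
vecMod x N = shiftMod x (+ 0) N

IsIncRearr : ∀ {n} → Vec ℤ n → Vec ℤ n → Set
IsIncRearr x c = Sorted (toList c) × (toList c ↭ toList x)

-- y lies in R_N(a): y is the increasing rearrangement of (a + i mod N) for some integer i
InR : ∀ {n} → ℕ → Vec ℤ n → Vec ℤ n → Set
InR N a y = ∃[ i ] IsIncRearr (shiftMod a i N) y

SameIncRearr : ∀ {n} → Vec ℤ n → Vec ℤ n → Set
SameIncRearr x y = ∃[ c ] (IsIncRearr x c × IsIncRearr y c)

IsQ : ℕ → ℕ → ℕ → Set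
IsQ r w q = (w ℕ.≤ q ℕ.* r) × (∀ m → w ℕ.≤ m ℕ.* r → q ℕ.≤ m)

-- conditions (I),(II),(III) on a weakly increasing vector b = (b_1,…,b_n);
-- b_j is  lookup b j'  with toℕ j' = j - 1.
SCond : (n r k : ℕ) → Vec ℤ n → Set
SCond n r k b =
  Σ (Fin n) λ j₁ → (toℕ j₁ ≡ 0) ×
  Σ (Fin n) λ jₙ → (suc (toℕ jₙ) ≡ n) ×
  Σ ℕ λ w → (1 ℕ.≤ w) × (w ℕ.≤ k) ×
    (lookup b j₁ ≡ + w) ×
    (lookup b jₙ ℤ.- lookup b j₁ ℤ.< + (r ℕ.* n) ℤ.- + k) ×
    (Σ (Fin n) λ jq → IsQ r w (suc (toℕ jq)) × (lookup b jq ≡ + w)) ×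
    (∀ (j : Fin n) → + w ℤ.< lookup b j → lookup b j ℤ.≤ + (toℕ j ℕ.* r))

InS : (n r k : ℕ) → Vec ℤ n → Set
InS n r k x = ∃[ c ] (IsIncRearr x c × SCond n r k c)

Counted : (n r k : ℕ) → Vec ℤ n → Vec ℤ n → Set
Counted n r k a b =
  Sorted (toList b) × InS n r k b ×
  ∃[ c ] (IsIncRearr (vecMod b (r ℕ.* n ℕ.∸ k)) c × InR (r ℕ.* n ℕ.∸ k) a c)

-- Write a = 1 + α with α ∈ [0, N)ⁿ. A counted b has b₁ = w ∈ [1, k] and all entries in [w, w + N), so
-- b = w + E with E ∈ [0, N)ⁿ. Conditions (II) and (III) become the ballot condition
-- w + y ≤ r · #{e ∈ E | e < y} for 1 ≤ y ≤ N, and (b mod N) ∈ R_N(a) says that E is the multiset of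
-- residues α + i − w for a shift i that is unique modulo p. So counted vectors correspond to pairs
-- (i mod p, w) satisfying the ballot condition.
-- Cycle lemma: with F t = Σⱼ ⌊(αⱼ + t)/N⌋ and Z t = r F t − t we have Z (t + N) = Z t + k, and the
-- admissible w for shift m are exactly those with w ≤ Z (m + N) − M m, where M m = max_{u<N} Z (m + u).
-- Their number is M (m + 1) − M m, so N consecutive shifts admit M N − M 0 = k pairs in total. The
-- condition is p-periodic in the shift and p ∣ N, hence one period contributes p k / N.

module Submission where

module FiniteSums where

  open import Level using (Level)
  open import Data.Nat
  open import Data.Nat.Properties
  open import Data.Nat.ListAction using (sum)
  open import Data.Nat.ListAction.Properties using (sum-↭)
  open import Data.List using (List; []; _∷_; map; length)
  import Data.List.Relation.Binary.Permutation.Propositional.Properties as ↭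
  open import Data.List.Relation.Binary.Permutation.Propositional using (_↭_)
  open import Relation.Nullary using (Dec; yes; no; ¬_; contradiction)
  open import Relation.Unary using (Pred; Decidable)
  open import Relation.Binary.PropositionalEquality
  open ≡-Reasoning
  open import Algebra.Properties.CommutativeSemigroup +-commutativeSemigroup using (interchange; xy∙z≈xz∙y)

  private variable
    a ℓ : Level
    A : Set a

  ∑< : ℕ → (ℕ → ℕ) → ℕ
  ∑< zero    f = 0
  ∑< (suc m) f = ∑< m f + f m

  syntax ∑< m (λ i → e) = ∑[ i < m ] e

  ∑<-cong : ∀ m {f g : ℕ → ℕ} → (∀ i → i < m → f i ≡ g i) → ∑< m f ≡ ∑< m g
  ∑<-cong zero    f≗g = refl
  ∑<-cong (suc m) f≗g = cong₂ _+_ (∑<-cong m λ i i<m → f≗g i (m<n⇒m<1+n i<m)) (f≗g m ≤-refl)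

  ∑<-zero : ∀ m → ∑[ i < m ] 0 ≡ 0
  ∑<-zero zero    = refl
  ∑<-zero (suc m) = cong (_+ 0) (∑<-zero m)

  ∑<-distrib-+ : ∀ m (f g : ℕ → ℕ) → ∑[ i < m ] (f i + g i) ≡ ∑< m f + ∑< m g
  ∑<-distrib-+ zero    f g = refl
  ∑<-distrib-+ (suc m) f g = begin
    ∑[ i < m ] (f i + g i) + (f m + g m)  ≡⟨ cong (_+ (f m + g m)) (∑<-distrib-+ m f g) ⟩
    ∑< m f + ∑< m g + (f m + g m)         ≡⟨ interchange (∑< m f) (∑< m g) (f m) (g m) ⟩
    ∑< m f + f m + (∑< m g + g m)         ∎

  ∑<-swap : ∀ m l (f : ℕ → ℕ → ℕ) → ∑[ i < m ] ∑[ j < l ] f i j ≡ ∑[ j < l ] ∑[ i < m ] f i j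
  ∑<-swap zero    l f = sym (∑<-zero l)
  ∑<-swap (suc m) l f = begin
    ∑[ i < m ] ∑[ j < l ] f i j + ∑[ j < l ] f m j  ≡⟨ cong (_+ ∑[ j < l ] f m j) (∑<-swap m l f) ⟩
    ∑[ j < l ] ∑[ i < m ] f i j + ∑[ j < l ] f m j  ≡⟨ ∑<-distrib-+ l (λ j → ∑[ i < m ] f i j) (f m) ⟨
    ∑[ j < l ] (∑[ i < m ] f i j + f m j)           ∎

  ∑<-split : ∀ m l f → ∑< (m + l) f ≡ ∑< m f + ∑[ i < l ] f (m + i)
  ∑<-split m zero    f = trans (cong (λ x → ∑< x f) (+-identityʳ m)) (sym (+-identityʳ _))
  ∑<-split m (suc l) f = begin
    ∑< (m + suc l) f                              ≡⟨ cong (λ x → ∑< x f) (+-suc m l) ⟩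
    ∑< (m + l) f + f (m + l)                      ≡⟨ cong (_+ f (m + l)) (∑<-split m l f) ⟩
    ∑< m f + ∑[ i < l ] f (m + i) + f (m + l)     ≡⟨ +-assoc (∑< m f) _ _ ⟩
    ∑< m f + (∑[ i < l ] f (m + i) + f (m + l))   ∎

  ∑<-periodic : ∀ q p f → (∀ i → f (p + i) ≡ f i) → ∑< (q * p) f ≡ q * ∑< p f
  ∑<-periodic zero    p f f-per = refl
  ∑<-periodic (suc q) p f f-per = begin
    ∑< (p + q * p) f                      ≡⟨ ∑<-split p (q * p) f ⟩
    ∑< p f + ∑[ i < q * p ] f (p + i)     ≡⟨ cong (∑< p f +_) (∑<-cong (q * p) λ i _ → f-per i) ⟩
    ∑< p f + ∑< (q * p) f                 ≡⟨ cong (∑< p f +_) (∑<-periodic q p f f-per) ⟩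
    ∑< p f + q * ∑< p f                   ∎

  ∑<-suc : ∀ m f → ∑[ i < m ] f (suc i) + f 0 ≡ ∑< m f + f m
  ∑<-suc zero    f = refl
  ∑<-suc (suc m) f = begin
    ∑[ i < m ] f (suc i) + f (suc m) + f 0   ≡⟨ xy∙z≈xz∙y (∑[ i < m ] f (suc i)) (f (suc m)) (f 0) ⟩
    ∑[ i < m ] f (suc i) + f 0 + f (suc m)   ≡⟨ cong (_+ f (suc m)) (∑<-suc m f) ⟩
    ∑< m f + f m + f (suc m)                 ∎

  ∑<-rotate : ∀ N f → (∀ i → f (i + N) ≡ f i) → ∀ c → ∑[ i < N ] f (c + i) ≡ ∑< N f
  ∑<-rotate N f f-per zero    = refl
  ∑<-rotate N f f-per (suc c) = +-cancelʳ-≡ (f c) _ _ (begin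
    ∑[ i < N ] f (suc c + i) + f c        ≡⟨ cong₂ _+_ (∑<-cong N λ i _ → cong f (sym (+-suc c i))) (cong f (sym (+-identityʳ c))) ⟩
    ∑[ i < N ] f (c + suc i) + f (c + 0)  ≡⟨ ∑<-suc N (λ i → f (c + i)) ⟩
    ∑[ i < N ] f (c + i) + f (c + N)      ≡⟨ cong₂ _+_ (∑<-rotate N f f-per c) (f-per c) ⟩
    ∑< N f + f c                          ∎)

  𝟙 : {P : Set ℓ} → Dec P → ℕ
  𝟙 (yes _) = 1
  𝟙 (no _)  = 0

  𝟙-cong : {P : Set ℓ} {Q : Set a} (P? : Dec P) (Q? : Dec Q) → (P → Q) → (Q → P) → 𝟙 P? ≡ 𝟙 Q?
  𝟙-cong (yes _) (yes _) P⇒Q Q⇒P = refl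
  𝟙-cong (yes p) (no ¬q) P⇒Q Q⇒P = contradiction (P⇒Q p) ¬q
  𝟙-cong (no ¬p) (yes q) P⇒Q Q⇒P = contradiction (Q⇒P q) ¬p
  𝟙-cong (no _)  (no _)  P⇒Q Q⇒P = refl

  𝟙-reject : {P : Set ℓ} (P? : Dec P) → ¬ P → 𝟙 P? ≡ 0
  𝟙-reject (yes p) ¬p = contradiction p ¬p
  𝟙-reject (no _)  ¬p = refl

  sum-map-+ : ∀ (f g : A → ℕ) xs → sum (map (λ x → f x + g x) xs) ≡ sum (map f xs) + sum (map g xs)
  sum-map-+ f g []       = refl
  sum-map-+ f g (x ∷ xs) = begin
    f x + g x + sum (map (λ x → f x + g x) xs)  ≡⟨ cong (f x + g x +_) (sum-map-+ f g xs) ⟩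
    f x + g x + (sum (map f xs) + sum (map g xs)) ≡⟨ interchange (f x) (g x) _ _ ⟩
    f x + sum (map f xs) + (g x + sum (map g xs)) ∎

  sum-map-1 : ∀ (xs : List A) → sum (map (λ _ → 1) xs) ≡ length xs
  sum-map-1 []       = refl
  sum-map-1 (x ∷ xs) = cong suc (sum-map-1 xs)

  count : {P : Pred A ℓ} → Decidable P → List A → ℕ
  count P? xs = sum (map (λ x → 𝟙 (P? x)) xs)

  count-↭ : {P : Pred A ℓ} (P? : Decidable P) {xs ys : List A} → xs ↭ ys → count P? xs ≡ count P? ys
  count-↭ P? xs↭ys = sum-↭ (↭.map⁺ (λ x → 𝟙 (P? x)) xs↭ys)

  count≤length : {P : Pred A ℓ} (P? : Decidable P) (xs : List A) → count P? xs ≤ length xs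
  count≤length P? []       = z≤n
  count≤length P? (x ∷ xs) with P? x
  ... | yes _ = s≤s (count≤length P? xs)
  ... | no _  = m≤n⇒m≤1+n (count≤length P? xs)

module ResidueShifts where

  open import Data.Nat
  open import Data.Nat.Properties
  open import Data.Nat.DivMod
  open import Data.Integer as ℤ using (ℤ)
  import Data.Integer.Properties as ℤ
  open import Data.List using (List; map)
  open import Data.List.Properties using (map-∘; map-cong; map-id-local)
  open import Data.List.Relation.Unary.All using (All)
  import Data.List.Relation.Unary.All as All
  open import Data.Product using (∃-syntax; _,_)
  open import Relation.Binary.Definitions using (tri<; tri≈; tri>)
  open import Relation.Binary.PropositionalEquality
  open ≡-Reasoning
  open import Data.Integer.Tactic.RingSolver using (solve-∀)
  open import Defs using (_mod⁺_)

  [m%n+o]%n≡[m+o]%n : ∀ m o n .{{_ : NonZero n}} → (m % n + o) % n ≡ (m + o) % n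
  [m%n+o]%n≡[m+o]%n m o n = begin
    (m % n + o) % n            ≡⟨ %-distribˡ-+ (m % n) o n ⟩
    (m % n % n + o % n) % n    ≡⟨ cong (λ x → (x + o % n) % n) (m%n%n≡m%n m n) ⟩
    (m % n + o % n) % n        ≡⟨ %-distribˡ-+ m o n ⟨
    (m + o) % n                ∎

  mod⁺≡ : ∀ {N} .{{_ : NonZero N}} s → s mod⁺ N ≡ ℤ.+ suc ((s ℤ.- ℤ.+ 1) ℤ.%ℕ N)
  mod⁺≡ {suc _} s = refl

  module Residues (N : ℕ) .{{_ : NonZero N}} where

    rot : ℕ → List ℕ → List ℕ
    rot m = map (λ x → (x + m) % N)

    rot-rot : ∀ m m' xs → rot m' (rot m xs) ≡ rot (m + m') xs
    rot-rot m m' xs = trans (sym (map-∘ xs)) (map-cong (λ x → begin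
      ((x + m) % N + m') % N   ≡⟨ [m%n+o]%n≡[m+o]%n (x + m) m' N ⟩
      (x + m + m') % N         ≡⟨ cong (_% N) (+-assoc x m m') ⟩
      (x + (m + m')) % N       ∎) xs)

    rot-+* : ∀ m c xs → rot (m + c * N) xs ≡ rot m xs
    rot-+* m c xs = map-cong (λ x → trans (cong (_% N) (sym (+-assoc x m (c * N)))) ([m+kn]%n≡m%n (x + m) c N)) xs

    rot-+N : ∀ m xs → rot (m + N) xs ≡ rot m xs
    rot-+N m xs = trans (cong (λ x → rot (m + x) xs) (sym (*-identityˡ N))) (rot-+* m 1 xs)

    rot-0 : ∀ {xs} → All (_< N) xs → rot 0 xs ≡ xs
    rot-0 xs<N = map-id-local (All.map (λ {x} x<N → trans (cong (_% N) (+-identityʳ x)) (m<n⇒m%n≡m x<N)) xs<N)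

    rot-inverse : ∀ ω {xs} → All (_< N) xs → rot (pred N * ω) (rot ω xs) ≡ xs
    rot-inverse ω {xs} xs<N = begin
      rot (pred N * ω) (rot ω xs)   ≡⟨ rot-rot ω (pred N * ω) xs ⟩
      rot (ω + pred N * ω) xs       ≡⟨ cong (λ m → rot m xs) (trans (cong (ω +_) (*-comm (pred N) ω)) (sym (*-suc ω (pred N)))) ⟩
      rot (ω * suc (pred N)) xs     ≡⟨ cong (λ m → rot (ω * m) xs) (suc-pred N) ⟩
      rot (ω * N) xs                ≡⟨ rot-+* 0 ω xs ⟩
      rot 0 xs                      ≡⟨ rot-0 xs<N ⟩
      xs                            ∎

    -- ℤ's _%ℕ_ computes on -[1+ n ] by cases on suc n % N; complement names the two outcomes.
    private
      complement : ℕ → ℕ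
      complement zero    = 0
      complement (suc x) = N ∸ suc x

      -[1+n]%ℕN : ∀ n → ℤ.-[1+ n ] ℤ.%ℕ N ≡ complement (suc n % N)
      -[1+n]%ℕN n with suc n % N
      ... | zero  = refl
      ... | suc _ = refl

    [i+N]%ℕN≡i%ℕN : ∀ i → (i ℤ.+ ℤ.+ N) ℤ.%ℕ N ≡ i ℤ.%ℕ N
    [i+N]%ℕN≡i%ℕN (ℤ.+ n)     = [m+n]%n≡m%n n N
    [i+N]%ℕN≡i%ℕN ℤ.-[1+ n ] with <-cmp (suc n) N
    ... | tri< n<N _ _ = begin
      (N ℤ.⊖ suc n) ℤ.%ℕ N          ≡⟨ cong (ℤ._%ℕ N) (ℤ.⊖-≥ (<⇒≤ n<N)) ⟩
      (N ∸ suc n) % N               ≡⟨ m<n⇒m%n≡m (∸-monoʳ-< {N} {suc n} {0} z<s (<⇒≤ n<N)) ⟩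
      complement (suc n)            ≡⟨ cong complement (m<n⇒m%n≡m n<N) ⟨
      complement (suc n % N)        ≡⟨ -[1+n]%ℕN n ⟨
      ℤ.-[1+ n ] ℤ.%ℕ N             ∎
    ... | tri≈ _ refl _ = begin
      (N ℤ.⊖ N) ℤ.%ℕ N              ≡⟨ cong (ℤ._%ℕ N) (ℤ.n⊖n≡0 N) ⟩
      complement 0                  ≡⟨ cong complement (n%n≡0 N) ⟨
      complement (N % N)            ≡⟨ -[1+n]%ℕN n ⟨
      ℤ.-[1+ n ] ℤ.%ℕ N             ∎
    ... | tri> _ _ N<n = begin
      (N ℤ.⊖ suc n) ℤ.%ℕ N                  ≡⟨ cong (ℤ._%ℕ N) (ℤ.⊖-< N<n) ⟩
      ℤ.- ℤ.+ (suc n ∸ N) ℤ.%ℕ N            ≡⟨ cong (λ x → ℤ.- ℤ.+ x ℤ.%ℕ N) (+-∸-assoc 1 N≤n) ⟩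
      ℤ.-[1+ n ∸ N ] ℤ.%ℕ N                 ≡⟨ -[1+n]%ℕN (n ∸ N) ⟩
      complement (suc (n ∸ N) % N)          ≡⟨ cong complement ([m+n]%n≡m%n (suc (n ∸ N)) N) ⟨
      complement ((suc (n ∸ N) + N) % N)    ≡⟨ cong (λ x → complement (suc x % N)) (m∸n+n≡m N≤n) ⟩
      complement (suc n % N)                ≡⟨ -[1+n]%ℕN n ⟨
      ℤ.-[1+ n ] ℤ.%ℕ N                     ∎
      where
      N≤n : N ≤ n
      N≤n = s≤s⁻¹ N<n

    [i+cN]%ℕN≡i%ℕN : ∀ c i → (i ℤ.+ ℤ.+ (c * N)) ℤ.%ℕ N ≡ i ℤ.%ℕ N
    [i+cN]%ℕN≡i%ℕN zero    i = cong (ℤ._%ℕ N) (ℤ.+-identityʳ i)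
    [i+cN]%ℕN≡i%ℕN (suc c) i = begin
      (i ℤ.+ ℤ.+ (N + c * N)) ℤ.%ℕ N        ≡⟨ cong (ℤ._%ℕ N) (ℤ-rearrange i (ℤ.+ N) (ℤ.+ (c * N))) ⟩
      (i ℤ.+ ℤ.+ (c * N) ℤ.+ ℤ.+ N) ℤ.%ℕ N  ≡⟨ [i+N]%ℕN≡i%ℕN (i ℤ.+ ℤ.+ (c * N)) ⟩
      (i ℤ.+ ℤ.+ (c * N)) ℤ.%ℕ N            ≡⟨ [i+cN]%ℕN≡i%ℕN c i ⟩
      i ℤ.%ℕ N                              ∎
      where
      ℤ-rearrange : ∀ x y z → x ℤ.+ (y ℤ.+ z) ≡ x ℤ.+ z ℤ.+ y
      ℤ-rearrange = solve-∀

    shift-natural : ∀ (i : ℤ) → ∃[ i' ] ∀ α → (ℤ.+ suc α ℤ.+ i) mod⁺ N ≡ ℤ.+ suc ((α + i') % N)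
    shift-natural (ℤ.+ m)     = m , λ α → mod⁺≡ (ℤ.+ suc α ℤ.+ ℤ.+ m)
    shift-natural ℤ.-[1+ m ] = suc m * N ∸ suc m , λ α → begin
      (ℤ.+ suc α ℤ.+ ℤ.-[1+ m ]) mod⁺ N                 ≡⟨ mod⁺≡ (ℤ.+ suc α ℤ.+ ℤ.-[1+ m ]) ⟩
      ℤ.+ suc (x α ℤ.%ℕ N)                              ≡⟨ cong (λ y → ℤ.+ suc y) ([i+cN]%ℕN≡i%ℕN (suc m) (x α)) ⟨
      ℤ.+ suc ((x α ℤ.+ ℤ.+ (suc m * N)) ℤ.%ℕ N)        ≡⟨ cong (λ y → ℤ.+ suc (y ℤ.%ℕ N)) (x+smN α) ⟩
      ℤ.+ suc ((α + (suc m * N ∸ suc m)) % N)          ∎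
      where
      x : ℕ → ℤ
      x α = ℤ.+ suc α ℤ.+ ℤ.-[1+ m ] ℤ.- ℤ.+ 1
      ℤ-identity : ∀ a s K → (ℤ.+ 1 ℤ.+ a ℤ.+ ℤ.- s ℤ.- ℤ.+ 1) ℤ.+ K ≡ a ℤ.+ (K ℤ.- s)
      ℤ-identity = solve-∀
      x+smN : ∀ α → x α ℤ.+ ℤ.+ (suc m * N) ≡ ℤ.+ (α + (suc m * N ∸ suc m))
      x+smN α = begin
        x α ℤ.+ ℤ.+ (suc m * N)                         ≡⟨ ℤ-identity (ℤ.+ α) (ℤ.+ suc m) (ℤ.+ (suc m * N)) ⟩
        ℤ.+ α ℤ.+ (ℤ.+ (suc m * N) ℤ.- ℤ.+ suc m)       ≡⟨ cong (ℤ._+_ (ℤ.+ α)) (ℤ.m-n≡m⊖n (suc m * N) (suc m)) ⟩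
        ℤ.+ α ℤ.+ (suc m * N ℤ.⊖ suc m)                 ≡⟨ cong (ℤ._+_ (ℤ.+ α)) (ℤ.⊖-≥ (m≤m*n (suc m) N)) ⟩
        ℤ.+ α ℤ.+ ℤ.+ (suc m * N ∸ suc m)               ∎

module IntegerSequences where

  open import Function using (_∘_)
  open import Data.Nat as ℕ using (ℕ; zero; suc; z≤n; s≤s)
  import Data.Nat.Properties as ℕ
  open import Data.Integer as ℤ using (ℤ; _+_; _-_; _≤_; _⊔_)
  import Data.Integer.Properties as ℤ
  open import Data.Sum using (inj₁; inj₂)
  open import Relation.Nullary using (yes; no)
  open import Relation.Binary.PropositionalEquality
  open ≡-Reasoning
  open import Data.Integer.Tactic.RingSolver using (solve-∀)
  open FiniteSums

  i≤j-k⇒i+k≤j : ∀ {i j k} → i ≤ j - k → i + k ≤ j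
  i≤j-k⇒i+k≤j {i} {j} {k} i≤j-k = subst (i + k ≤_) (j-k+k≡j j k) (ℤ.+-monoˡ-≤ k i≤j-k)
    where
    j-k+k≡j : ∀ j k → j - k + k ≡ j
    j-k+k≡j = solve-∀

  i+k≤j⇒i≤j-k : ∀ {i j k} → i + k ≤ j → i ≤ j - k
  i+k≤j⇒i≤j-k {i} {j} {k} i+k≤j = subst (_≤ j - k) (i+k-k≡i i k) (ℤ.+-monoˡ-≤ (ℤ.- k) i+k≤j)
    where
    i+k-k≡i : ∀ i k → i + k - k ≡ i
    i+k-k≡i = solve-∀

  i≤j-k⇒k≤j-i : ∀ {i j k} → i ≤ j - k → k ≤ j - i
  i≤j-k⇒k≤j-i {i} {j} {k} i≤j-k = i+k≤j⇒i≤j-k (subst (_≤ j) (ℤ.+-comm i k) (i≤j-k⇒i+k≤j i≤j-k))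

  [i⊔j]-i≡[j-i]⊔0 : ∀ i j → (i ⊔ j) - i ≡ (j - i) ⊔ ℤ.0ℤ
  [i⊔j]-i≡[j-i]⊔0 i j with ℤ.≤-total i j
  ... | inj₁ i≤j = trans (cong (_- i) (ℤ.i≤j⇒i⊔j≡j i≤j)) (sym (ℤ.i≥j⇒i⊔j≡i (ℤ.i≤j⇒0≤j-i i≤j)))
  ... | inj₂ j≤i = trans (cong (_- i) (ℤ.i≥j⇒i⊔j≡i j≤i))
                     (trans (ℤ.+-inverseʳ i) (sym (ℤ.i≤j⇒i⊔j≡j (ℤ.i≤j⇒i-j≤0 j≤i))))

  ∑<-telescope : ∀ (f : ℕ → ℕ) (g : ℕ → ℤ) → (∀ m → ℤ.+ f m ≡ g (suc m) - g m) →
                 ∀ M → ℤ.+ ∑< M f + g 0 ≡ g M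
  ∑<-telescope f g step zero    = ℤ.+-identityˡ (g 0)
  ∑<-telescope f g step (suc M) = begin
    ℤ.+ (∑< M f ℕ.+ f M) + g 0           ≡⟨ cong (_+ g 0) (ℤ.pos-+ (∑< M f) (f M)) ⟩
    ℤ.+ ∑< M f + ℤ.+ f M + g 0           ≡⟨ rearrange (ℤ.+ ∑< M f) (ℤ.+ f M) (g 0) ⟩
    ℤ.+ ∑< M f + g 0 + ℤ.+ f M           ≡⟨ cong₂ _+_ (∑<-telescope f g step M) (step M) ⟩
    g M + (g (suc M) - g M)              ≡⟨ cancel (g M) (g (suc M)) ⟩
    g (suc M)                            ∎
    where
    rearrange : ∀ a b c → a + b + c ≡ a + c + b
    rearrange = solve-∀
    cancel : ∀ a b → a + (b - a) ≡ b
    cancel = solve-∀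

  ∑<-𝟙-suc≤ : ∀ d k → ∑[ j < k ] 𝟙 (suc j ℕ.≤? d) ≡ d ℕ.⊓ k
  ∑<-𝟙-suc≤ d zero = sym (ℕ.⊓-zeroʳ d)
  ∑<-𝟙-suc≤ d (suc k) with suc k ℕ.≤? d
  ... | yes k<d = begin
    ∑[ j < k ] 𝟙 (suc j ℕ.≤? d) ℕ.+ 1   ≡⟨ cong (ℕ._+ 1) (∑<-𝟙-suc≤ d k) ⟩
    d ℕ.⊓ k ℕ.+ 1                        ≡⟨ cong (ℕ._+ 1) (ℕ.m≥n⇒m⊓n≡n (ℕ.<⇒≤ k<d)) ⟩
    k ℕ.+ 1                              ≡⟨ ℕ.+-comm k 1 ⟩
    suc k                                ≡⟨ ℕ.m≥n⇒m⊓n≡n k<d ⟨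
    d ℕ.⊓ suc k                          ∎
  ... | no k≮d = begin
    ∑[ j < k ] 𝟙 (suc j ℕ.≤? d) ℕ.+ 0   ≡⟨ ℕ.+-identityʳ _ ⟩
    ∑[ j < k ] 𝟙 (suc j ℕ.≤? d)         ≡⟨ ∑<-𝟙-suc≤ d k ⟩
    d ℕ.⊓ k                              ≡⟨ ℕ.m≤n⇒m⊓n≡m d≤k ⟩
    d                                    ≡⟨ ℕ.m≤n⇒m⊓n≡m (ℕ.m≤n⇒m≤1+n d≤k) ⟨
    d ℕ.⊓ suc k                          ∎
    where
    d≤k = ℕ.s≤s⁻¹ (ℕ.≰⇒> k≮d)

  ∑<-𝟙-+suc≤ : ∀ {k} x → x ≤ ℤ.+ k → ℤ.+ ∑[ j < k ] 𝟙 (ℤ.+ suc j ℤ.≤? x) ≡ x ⊔ ℤ.0ℤ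
  ∑<-𝟙-+suc≤ {k} (ℤ.+ d) (ℤ.+≤+ d≤k) = begin
    ℤ.+ ∑[ j < k ] 𝟙 (ℤ.+ suc j ℤ.≤? ℤ.+ d)   ≡⟨ cong ℤ.+_ (∑<-cong k λ j _ → 𝟙-cong _ _ ℤ.drop‿+≤+ ℤ.+≤+) ⟩
    ℤ.+ ∑[ j < k ] 𝟙 (suc j ℕ.≤? d)          ≡⟨ cong ℤ.+_ (trans (∑<-𝟙-suc≤ d k) (ℕ.m≤n⇒m⊓n≡m d≤k)) ⟩
    ℤ.+ d                                     ≡⟨ ℤ.i≥j⇒i⊔j≡i (ℤ.+≤+ z≤n) ⟨
    ℤ.+ d ⊔ ℤ.0ℤ                              ∎
  ∑<-𝟙-+suc≤ {k} ℤ.-[1+ d ] _ = cong ℤ.+_ (trans (∑<-cong k λ j _ → 𝟙-reject (ℤ.+ suc j ℤ.≤? ℤ.-[1+ d ]) λ ()) (∑<-zero k))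

  max≤ : (ℕ → ℤ) → ℕ → ℤ
  max≤ f zero    = f 0
  max≤ f (suc j) = max≤ f j ⊔ f (suc j)

  ≤-max≤ : ∀ f {u} j → u ℕ.≤ j → f u ≤ max≤ f j
  ≤-max≤ f zero    z≤n = ℤ.≤-refl
  ≤-max≤ f (suc j) u≤1+j with ℕ.m≤n⇒m<n∨m≡n u≤1+j
  ... | inj₁ u≤j  = ℤ.≤-trans (≤-max≤ f j (ℕ.s≤s⁻¹ u≤j)) (ℤ.i≤i⊔j _ _)
  ... | inj₂ refl = ℤ.i≤j⊔i _ _

  max≤-lub : ∀ f j {v} → (∀ u → u ℕ.≤ j → f u ≤ v) → max≤ f j ≤ v
  max≤-lub f zero    f≤v = f≤v 0 z≤n
  max≤-lub f (suc j) f≤v = ℤ.⊔-lub (max≤-lub f j λ u u≤j → f≤v u (ℕ.m≤n⇒m≤1+n u≤j)) (f≤v (suc j) ℕ.≤-refl)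

  max≤-cong : ∀ {f g} j → (∀ u → f u ≡ g u) → max≤ f j ≡ max≤ g j
  max≤-cong zero    f≗g = f≗g 0
  max≤-cong (suc j) f≗g = cong₂ _⊔_ (max≤-cong j f≗g) (f≗g (suc j))

  max≤-+ : ∀ f j c → max≤ (λ u → f u + c) j ≡ max≤ f j + c
  max≤-+ f zero    c = refl
  max≤-+ f (suc j) c = begin
    max≤ (λ u → f u + c) j ⊔ (f (suc j) + c)   ≡⟨ cong (_⊔ (f (suc j) + c)) (max≤-+ f j c) ⟩
    (max≤ f j + c) ⊔ (f (suc j) + c)           ≡⟨ ℤ.mono-≤-distrib-⊔ (ℤ.+-monoˡ-≤ c) (max≤ f j) (f (suc j)) ⟨
    (max≤ f j ⊔ f (suc j)) + c                 ∎

  max≤-suc : ∀ f j → max≤ f (suc j) ≡ f 0 ⊔ max≤ (f ∘ suc) j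
  max≤-suc f zero    = refl
  max≤-suc f (suc j) = begin
    max≤ f (suc j) ⊔ f (suc (suc j))                 ≡⟨ cong (_⊔ f (suc (suc j))) (max≤-suc f j) ⟩
    f 0 ⊔ max≤ (f ∘ suc) j ⊔ f (suc (suc j))         ≡⟨ ℤ.⊔-assoc (f 0) _ _ ⟩
    f 0 ⊔ (max≤ (f ∘ suc) j ⊔ f (suc (suc j)))       ∎

  max≤-slide : ∀ f j → f 0 ≤ f (suc j) → max≤ (f ∘ suc) j ≡ max≤ f j ⊔ f (suc j)
  max≤-slide f j f0≤f[1+j] = begin
    max≤ (f ∘ suc) j              ≡⟨ ℤ.i≤j⇒i⊔j≡j (ℤ.≤-trans f0≤f[1+j] (≤-max≤ (f ∘ suc) j ℕ.≤-refl)) ⟨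
    f 0 ⊔ max≤ (f ∘ suc) j        ≡⟨ max≤-suc f j ⟨
    max≤ f j ⊔ f (suc j)          ∎

module Cycle where

  open import Data.Nat
  open import Data.Nat.Properties
  open import Data.Nat.DivMod
  open import Data.Nat.Divisibility using (n∣m*n)
  open import Data.Nat.ListAction using (sum)
  open import Data.Integer as ℤ using (ℤ)
  import Data.Integer.Properties as ℤ
  open import Data.List using (List; map; length)
  open import Data.List.Properties using (map-∘; map-cong)
  open import Data.List.Relation.Binary.Permutation.Propositional using (_↭_)
  open import Relation.Nullary using (Dec; yes; no)
  open import Relation.Binary.PropositionalEquality
  open ≡-Reasoning
  open import Algebra.Properties.CommutativeSemigroup +-commutativeSemigroup using (xy∙z≈xz∙y)
  open import Data.Integer.Tactic.RingSolver using (solve-∀)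
  open import Algebra.Properties.AbelianGroup ℤ.+-0-abelianGroup using (∙-cancelʳ)
  open FiniteSums
  open ResidueShifts
  open IntegerSequences

  [m+kn]/n≡m/n+k : ∀ m k n .{{_ : NonZero n}} → (m + k * n) / n ≡ m / n + k
  [m+kn]/n≡m/n+k m k n = trans (+-distrib-/-∣ʳ m (n∣m*n k)) (cong (m / n +_) (m*n/n≡m k n))

  [ρ+N∸y]/N+𝟙[ρ<y]≡1 : ∀ {ρ N y} .{{_ : NonZero N}} → ρ < N → y ≤ N → (ρ + (N ∸ y)) / N + 𝟙 (ρ <? y) ≡ 1
  [ρ+N∸y]/N+𝟙[ρ<y]≡1 {ρ} {N} {y} ρ<N y≤N with ρ <? y
  ... | yes ρ<y = cong (_+ 1) (m<n⇒m/n≡0 (subst (ρ + (N ∸ y) <_) (m+[n∸m]≡n y≤N) (+-monoˡ-< (N ∸ y) ρ<y)))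
  ... | no ρ≮y = begin
    (ρ + (N ∸ y)) / N + 0       ≡⟨ +-identityʳ _ ⟩
    (ρ + (N ∸ y)) / N           ≡⟨ cong (_/ N) ρ+N∸y≡ρ∸y+N ⟩
    (ρ ∸ y + 1 * N) / N         ≡⟨ [m+kn]/n≡m/n+k (ρ ∸ y) 1 N ⟩
    (ρ ∸ y) / N + 1             ≡⟨ cong (_+ 1) (m<n⇒m/n≡0 (≤-<-trans (m∸n≤m ρ y) ρ<N)) ⟩
    1                           ∎
    where
    y≤ρ = ≮⇒≥ ρ≮y
    ρ+N∸y≡ρ∸y+N : ρ + (N ∸ y) ≡ ρ ∸ y + 1 * N
    ρ+N∸y≡ρ∸y+N = begin
      ρ + (N ∸ y)             ≡⟨ cong (_+ (N ∸ y)) (m∸n+n≡m y≤ρ) ⟨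
      ρ ∸ y + y + (N ∸ y)     ≡⟨ +-assoc (ρ ∸ y) y (N ∸ y) ⟩
      ρ ∸ y + (y + (N ∸ y))   ≡⟨ cong (ρ ∸ y +_) (trans (m+[n∸m]≡n y≤N) (sym (*-identityˡ N))) ⟩
      ρ ∸ y + 1 * N           ∎

  [a+N∸y]/N+𝟙[a%N<y]≡a/N+1 : ∀ a {N y} .{{_ : NonZero N}} → y ≤ N →
                              (a + (N ∸ y)) / N + 𝟙 (a % N <? y) ≡ a / N + 1
  [a+N∸y]/N+𝟙[a%N<y]≡a/N+1 a {N} {y} y≤N = begin
    (a + (N ∸ y)) / N + 𝟙 (ρ <? y)                ≡⟨ cong (λ x → (x + (N ∸ y)) / N + 𝟙 (ρ <? y)) (m≡m%n+[m/n]*n a N) ⟩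
    (ρ + q * N + (N ∸ y)) / N + 𝟙 (ρ <? y)        ≡⟨ cong (λ x → x / N + 𝟙 (ρ <? y)) (xy∙z≈xz∙y ρ (q * N) (N ∸ y)) ⟩
    (ρ + (N ∸ y) + q * N) / N + 𝟙 (ρ <? y)        ≡⟨ cong (_+ 𝟙 (ρ <? y)) ([m+kn]/n≡m/n+k (ρ + (N ∸ y)) q N) ⟩
    (ρ + (N ∸ y)) / N + q + 𝟙 (ρ <? y)            ≡⟨ xy∙z≈xz∙y ((ρ + (N ∸ y)) / N) q (𝟙 (ρ <? y)) ⟩
    (ρ + (N ∸ y)) / N + 𝟙 (ρ <? y) + q            ≡⟨ cong (_+ q) ([ρ+N∸y]/N+𝟙[ρ<y]≡1 (m%n<n a N) y≤N) ⟩
    1 + q                                         ≡⟨ +-comm 1 q ⟩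
    q + 1                                         ∎
    where
    q = a / N
    ρ = a % N

  #< : ℕ → List ℕ → ℕ
  #< y = count (_<? y)

  module Walks (N r : ℕ) where

    -- With w = b₁ and E the entries of b − b₁, Walk w E is the counting form of conditions (II) and (III).
    Walk : ℕ → List ℕ → Set
    Walk w xs = ∀ {t} → t < N → w + suc t ≤ r * #< (suc t) xs

    walk? : ∀ w xs → Dec (Walk w xs)
    walk? w xs = allUpTo? (λ t → w + suc t ≤? r * #< (suc t) xs) N

    walk-↭ : ∀ {w xs ys} → xs ↭ ys → Walk w xs → Walk w ys
    walk-↭ {w} xs↭ys walk {t} t<N = subst (λ c → w + suc t ≤ r * c) (count-↭ (_<? suc t) xs↭ys) (walk t<N)

  module CycleLemma (N : ℕ) .{{_ : NonZero N}} (r k n : ℕ) (N+k≡rn : N + k ≡ r * n)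
                    (αs : List ℕ) (|αs|≡n : length αs ≡ n) where

    open Residues N
    open Walks N r

    F : ℕ → ℕ
    F t = sum (map (λ α → (α + t) / N) αs)

    F-+N : ∀ t → F (t + N) ≡ F t + n
    F-+N t = begin
      sum (map (λ α → (α + (t + N)) / N) αs)      ≡⟨ cong sum (map-cong (λ α → [α+t+N]/N α) αs) ⟩
      sum (map (λ α → (α + t) / N + 1) αs)        ≡⟨ sum-map-+ (λ α → (α + t) / N) (λ _ → 1) αs ⟩
      F t + sum (map (λ _ → 1) αs)                ≡⟨ cong (F t +_) (trans (sum-map-1 αs) |αs|≡n) ⟩
      F t + n                                     ∎
      where
      [α+t+N]/N : ∀ α → (α + (t + N)) / N ≡ (α + t) / N + 1
      [α+t+N]/N α = trans (cong (_/ N) (trans (sym (+-assoc α t N)) (cong (α + t +_) (sym (*-identityˡ N)))))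
                          ([m+kn]/n≡m/n+k (α + t) 1 N)

    F-+N∸y : ∀ m {y} → y ≤ N → F (m + (N ∸ y)) + #< y (rot m αs) ≡ F m + n
    F-+N∸y m {y} y≤N = begin
      F (m + (N ∸ y)) + #< y (rot m αs)
        ≡⟨ cong (F (m + (N ∸ y)) +_) (cong sum (sym (map-∘ αs))) ⟩
      F (m + (N ∸ y)) + sum (map (λ α → 𝟙 ((α + m) % N <? y)) αs)
        ≡⟨ sum-map-+ (λ α → (α + (m + (N ∸ y))) / N) (λ α → 𝟙 ((α + m) % N <? y)) αs ⟨
      sum (map (λ α → (α + (m + (N ∸ y))) / N + 𝟙 ((α + m) % N <? y)) αs)
        ≡⟨ cong sum (map-cong (λ α → trans (cong (λ x → x / N + 𝟙 ((α + m) % N <? y)) (sym (+-assoc α m (N ∸ y))))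
                                              ([a+N∸y]/N+𝟙[a%N<y]≡a/N+1 (α + m) y≤N)) αs) ⟩
      sum (map (λ α → (α + m) / N + 1) αs)
        ≡⟨ sum-map-+ (λ α → (α + m) / N) (λ _ → 1) αs ⟩
      F m + sum (map (λ _ → 1) αs)
        ≡⟨ cong (F m +_) (trans (sum-map-1 αs) |αs|≡n) ⟩
      F m + n ∎

    Z : ℕ → ℤ
    Z t = ℤ.+ (r * F t) ℤ.- ℤ.+ t

    Z-+N : ∀ t → Z (t + N) ≡ Z t ℤ.+ ℤ.+ k
    Z-+N t = begin
      ℤ.+ (r * F (t + N)) ℤ.- ℤ.+ (t + N)                   ≡⟨ cong₂ (λ x y → ℤ.+ x ℤ.- y) r*F[t+N] (ℤ.pos-+ t N) ⟩
      ℤ.+ (r * F t) ℤ.+ (ℤ.+ N ℤ.+ ℤ.+ k) ℤ.- (ℤ.+ t ℤ.+ ℤ.+ N) ≡⟨ rearrange (ℤ.+ (r * F t)) (ℤ.+ N) (ℤ.+ k) (ℤ.+ t) ⟩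
      Z t ℤ.+ ℤ.+ k                                         ∎
      where
      rearrange : ∀ a b c d → a ℤ.+ (b ℤ.+ c) ℤ.- (d ℤ.+ b) ≡ a ℤ.- d ℤ.+ c
      rearrange = solve-∀
      r*F[t+N] : r * F (t + N) ≡ r * F t + (N + k)
      r*F[t+N] = trans (cong (r *_) (F-+N t)) (trans (*-distribˡ-+ r (F t) n) (cong (r * F t +_) (sym N+k≡rn)))

    Z-drop : ∀ m {y} → y ≤ N → Z (m + N) ℤ.- Z (m + (N ∸ y)) ≡ ℤ.+ (r * #< y (rot m αs)) ℤ.- ℤ.+ y
    Z-drop m {y} y≤N = begin
      ℤ.+ (r * F (m + N)) ℤ.- ℤ.+ (m + N) ℤ.- (ℤ.+ (r * A) ℤ.- ℤ.+ P)
        ≡⟨ cong₂ (λ x z → ℤ.+ (r * x) ℤ.- ℤ.+ z ℤ.- (ℤ.+ (r * A) ℤ.- ℤ.+ P)) F[m+N] m+N≡P+y ⟩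
      ℤ.+ (r * (A + D)) ℤ.- ℤ.+ (P + y) ℤ.- (ℤ.+ (r * A) ℤ.- ℤ.+ P)
        ≡⟨ cong₂ (λ x z → x ℤ.- z ℤ.- (ℤ.+ (r * A) ℤ.- ℤ.+ P)) (cong ℤ.+_ (*-distribˡ-+ r A D)) (ℤ.pos-+ P y) ⟩
      ℤ.+ (r * A + r * D) ℤ.- (ℤ.+ P ℤ.+ ℤ.+ y) ℤ.- (ℤ.+ (r * A) ℤ.- ℤ.+ P)
        ≡⟨ cong (λ x → x ℤ.- (ℤ.+ P ℤ.+ ℤ.+ y) ℤ.- (ℤ.+ (r * A) ℤ.- ℤ.+ P)) (ℤ.pos-+ (r * A) (r * D)) ⟩
      ℤ.+ (r * A) ℤ.+ ℤ.+ (r * D) ℤ.- (ℤ.+ P ℤ.+ ℤ.+ y) ℤ.- (ℤ.+ (r * A) ℤ.- ℤ.+ P)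
        ≡⟨ cancel (ℤ.+ (r * A)) (ℤ.+ (r * D)) (ℤ.+ P) (ℤ.+ y) ⟩
      ℤ.+ (r * D) ℤ.- ℤ.+ y ∎
      where
      A = F (m + (N ∸ y))
      D = #< y (rot m αs)
      P = m + (N ∸ y)
      F[m+N] : F (m + N) ≡ A + D
      F[m+N] = trans (F-+N m) (sym (F-+N∸y m y≤N))
      m+N≡P+y : m + N ≡ P + y
      m+N≡P+y = trans (cong (m +_) (sym (m∸n+n≡m y≤N))) (sym (+-assoc m (N ∸ y) y))
      cancel : ∀ a d p y → a ℤ.+ d ℤ.- (p ℤ.+ y) ℤ.- (a ℤ.- p) ≡ d ℤ.- y
      cancel = solve-∀

    walk-step : ∀ m w {t} → t < N → w + suc t ≤ r * #< (suc t) (rot m αs) →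
                ℤ.+ w ℤ.≤ Z (m + N) ℤ.- Z (m + (N ∸ suc t))
    walk-step m w {t} t<N w+1+t≤ = subst (ℤ.+ w ℤ.≤_) (sym (Z-drop m t<N))
      (i+k≤j⇒i≤j-k {k = ℤ.+ suc t} (subst (ℤ._≤ ℤ.+ (r * #< (suc t) (rot m αs))) (ℤ.pos-+ w (suc t)) (ℤ.+≤+ w+1+t≤)))

    step-walk : ∀ m w {t} → t < N → ℤ.+ w ℤ.≤ Z (m + N) ℤ.- Z (m + (N ∸ suc t)) →
                w + suc t ≤ r * #< (suc t) (rot m αs)
    step-walk m w {t} t<N w≤ = ℤ.drop‿+≤+ (subst (ℤ._≤ ℤ.+ (r * #< (suc t) (rot m αs))) (sym (ℤ.pos-+ w (suc t)))
      (i≤j-k⇒i+k≤j {k = ℤ.+ suc t} (subst (ℤ.+ w ℤ.≤_) (Z-drop m t<N) w≤)))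

    M : ℕ → ℤ
    M m = max≤ (λ u → Z (m + u)) (pred N)

    Z≤M : ∀ m {u} → u < N → Z (m + u) ℤ.≤ M m
    Z≤M m u<N = ≤-max≤ (λ u → Z (m + u)) (pred N) (<⇒≤pred u<N)

    M-suc : ∀ m → M (suc m) ≡ M m ℤ.⊔ Z (m + N)
    M-suc m = begin
      max≤ (λ u → Z (suc m + u)) (pred N)          ≡⟨ max≤-cong (pred N) (λ u → cong Z (sym (+-suc m u))) ⟩
      max≤ (λ u → Z (m + suc u)) (pred N)          ≡⟨ max≤-slide (λ u → Z (m + u)) (pred N) Z[m]≤Z[m+N] ⟩
      M m ℤ.⊔ Z (m + suc (pred N))                 ≡⟨ cong (λ x → M m ℤ.⊔ Z (m + x)) (suc-pred N) ⟩
      M m ℤ.⊔ Z (m + N)                            ∎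
      where
      Z[m]≤Z[m+N] : Z (m + 0) ℤ.≤ Z (m + suc (pred N))
      Z[m]≤Z[m+N] = subst₂ (λ x y → Z x ℤ.≤ Z y) (sym (+-identityʳ m)) (cong (m +_) (sym (suc-pred N)))
                      (subst (Z m ℤ.≤_) (sym (Z-+N m)) (ℤ.i≤i+j (Z m) (ℤ.+ k)))

    M-+N : ∀ m → M (m + N) ≡ M m ℤ.+ ℤ.+ k
    M-+N m = trans (max≤-cong (pred N) (λ u → trans (cong Z (xy∙z≈xz∙y m N u)) (Z-+N (m + u))))
                   (max≤-+ (λ u → Z (m + u)) (pred N) (ℤ.+ k))

    δ : ℕ → ℤ
    δ m = Z (m + N) ℤ.- M m

    δ≤k : ∀ m → δ m ℤ.≤ ℤ.+ k
    δ≤k m = ℤ.≤-trans (ℤ.+-monoʳ-≤ (Z (m + N)) (ℤ.neg-mono-≤ (Z≤M m (>-nonZero⁻¹ N))))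
                       (ℤ.≤-reflexive (Z[m+N]-Z[m]≡k))
      where
      Z[m+N]-Z[m]≡k : Z (m + N) ℤ.- Z (m + 0) ≡ ℤ.+ k
      Z[m+N]-Z[m]≡k = trans (cong₂ ℤ._-_ (Z-+N m) (cong Z (+-identityʳ m))) (cancel (Z m) (ℤ.+ k))
        where
        cancel : ∀ a b → a ℤ.+ b ℤ.- a ≡ b
        cancel = solve-∀

    walk⇒≤δ : ∀ m w → Walk w (rot m αs) → ℤ.+ w ℤ.≤ δ m
    walk⇒≤δ m w walk = i≤j-k⇒k≤j-i {j = Z (m + N)} (max≤-lub (λ u → Z (m + u)) (pred N) λ u u≤pred[N] →
      i≤j-k⇒k≤j-i {j = Z (m + N)} (subst (λ x → ℤ.+ w ℤ.≤ Z (m + N) ℤ.- Z (m + x)) (N∸[N∸u]≡u u≤pred[N])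
                          (walk-step m w (t<N u) (walk (t<N u)))))
      where
      t<N : ∀ u → pred N ∸ u < N
      t<N u = ≤-<-trans (m∸n≤m (pred N) u) (subst (pred N <_) (suc-pred N) ≤-refl)
      N∸[N∸u]≡u : ∀ {u} → u ≤ pred N → N ∸ suc (pred N ∸ u) ≡ u
      N∸[N∸u]≡u {u} u≤pred[N] = begin
        N ∸ suc (pred N ∸ u)    ≡⟨ cong (N ∸_) (sym (+-∸-assoc 1 u≤pred[N])) ⟩
        N ∸ (suc (pred N) ∸ u)  ≡⟨ cong (λ x → N ∸ (x ∸ u)) (suc-pred N) ⟩
        N ∸ (N ∸ u)             ≡⟨ m∸[m∸n]≡n (≤-trans u≤pred[N] (subst (pred N ≤_) (suc-pred N) (n≤1+n _))) ⟩
        u                       ∎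

    ≤δ⇒walk : ∀ m w → ℤ.+ w ℤ.≤ δ m → Walk w (rot m αs)
    ≤δ⇒walk m w w≤δ {t} t<N = step-walk m w t<N
      (i≤j-k⇒k≤j-i {j = Z (m + N)} (ℤ.≤-trans (Z≤M m (∸-monoʳ-< z<s t<N)) (i≤j-k⇒k≤j-i {j = Z (m + N)} w≤δ)))

    #walks : ℕ → ℕ
    #walks m = ∑[ j < k ] 𝟙 (walk? (suc j) (rot m αs))

    #walks≡ΔM : ∀ m → ℤ.+ #walks m ≡ M (suc m) ℤ.- M m
    #walks≡ΔM m = begin
      ℤ.+ ∑[ j < k ] 𝟙 (walk? (suc j) (rot m αs))
        ≡⟨ cong ℤ.+_ (∑<-cong k λ j _ → 𝟙-cong _ _ (walk⇒≤δ m (suc j)) (≤δ⇒walk m (suc j))) ⟩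
      ℤ.+ ∑[ j < k ] 𝟙 (ℤ.+ suc j ℤ.≤? δ m)          ≡⟨ ∑<-𝟙-+suc≤ (δ m) (δ≤k m) ⟩
      δ m ℤ.⊔ ℤ.0ℤ                                  ≡⟨ [i⊔j]-i≡[j-i]⊔0 (M m) (Z (m + N)) ⟨
      (M m ℤ.⊔ Z (m + N)) ℤ.- M m                   ≡⟨ cong (ℤ._- M m) (M-suc m) ⟨
      M (suc m) ℤ.- M m                             ∎

    ∑#walks≡k : ∑[ m < N ] #walks m ≡ k
    ∑#walks≡k = ℤ.+-injective (∙-cancelʳ (M 0) _ _ (begin
      ℤ.+ ∑[ m < N ] #walks m ℤ.+ M 0   ≡⟨ ∑<-telescope #walks M #walks≡ΔM N ⟩
      M N                               ≡⟨ M-+N 0 ⟩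
      M 0 ℤ.+ ℤ.+ k                     ≡⟨ ℤ.+-comm (M 0) (ℤ.+ k) ⟩
      ℤ.+ k ℤ.+ M 0                     ∎))

    cycle-lemma : ∀ (c : ℕ → ℕ) → ∑[ m < N ] ∑[ j < k ] 𝟙 (walk? (suc j) (rot (m + c j) αs)) ≡ k
    cycle-lemma c = begin
      ∑[ m < N ] ∑[ j < k ] 𝟙 (walk? (suc j) (rot (m + c j) αs))   ≡⟨ ∑<-swap N k _ ⟩
      ∑[ j < k ] ∑[ m < N ] 𝟙 (walk? (suc j) (rot (m + c j) αs))   ≡⟨ ∑<-cong k (λ j _ → rotate j) ⟩
      ∑[ j < k ] ∑[ m < N ] 𝟙 (walk? (suc j) (rot m αs))           ≡⟨ ∑<-swap N k _ ⟨
      ∑[ m < N ] #walks m                                         ≡⟨ ∑#walks≡k ⟩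
      k                                                           ∎
      where
      rotate : ∀ j → ∑[ m < N ] 𝟙 (walk? (suc j) (rot (m + c j) αs)) ≡ ∑[ m < N ] 𝟙 (walk? (suc j) (rot m αs))
      rotate j = trans (∑<-cong N λ m _ → cong (λ x → 𝟙 (walk? (suc j) (rot x αs))) (+-comm m (c j)))
                       (∑<-rotate N (λ m → 𝟙 (walk? (suc j) (rot m αs)))
                          (λ m → cong (λ xs → 𝟙 (walk? (suc j) xs)) (rot-+N m αs)) (c j))

module SortedVectors where

  open import Level using (0ℓ)
  open import Data.Nat as ℕ using (ℕ; zero; suc; z≤n; s≤s)
  import Data.Nat.Properties as ℕ
  open import Data.Integer using (ℤ)
  import Data.Integer.Properties as ℤ
  open import Data.Fin using (zero; suc; toℕ)
  open import Data.List using (List; []; _∷_; length)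
  open import Data.Vec using (Vec; _∷_; toList; fromList; lookup)
  open import Data.Vec.Properties using (toList∘fromList; toList-injective; cast-is-id)
  open import Data.List.Relation.Binary.Permutation.Propositional using (_↭_; ↭⇒↭ₛ)
  import Data.List.Relation.Binary.Permutation.Propositional.Properties as ↭
  open import Data.List.Relation.Binary.Pointwise using (Pointwise-≡⇒≡)
  open import Data.List.Relation.Unary.Linked as Linked using (_∷_)
  open import Data.List.Relation.Unary.Sorted.TotalOrder using (Sorted)
  open import Data.List.Relation.Unary.Sorted.TotalOrder.Properties using (↗↭↗⇒≋)
  import Data.List.Sort as Sort
  open import Relation.Binary.Bundles using (TotalOrder; DecTotalOrder)
  open import Relation.Nullary using (yes; no)
  open import Relation.Binary.PropositionalEquality
  open FiniteSums
  open Cycle using (#<)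

  module _ (O : TotalOrder 0ℓ 0ℓ 0ℓ) where
    open TotalOrder O using (Carrier; _≤_) renaming (refl to ≤-refl; trans to ≤-trans)

    lookup-mono : ∀ {m} (v : Vec Carrier m) → Sorted O (toList v) →
                  ∀ {i j} → toℕ i ℕ.≤ toℕ j → lookup v i ≤ lookup v j
    lookup-mono (x ∷ v)     v↗         {zero}  {zero}  _         = ≤-refl
    lookup-mono (x ∷ y ∷ v) (x≤y ∷ v↗) {zero}  {suc j} _         = ≤-trans x≤y (lookup-mono (y ∷ v) v↗ {zero} {j} z≤n)
    lookup-mono (x ∷ v)     v↗         {suc i} {suc j} (s≤s i≤j) = lookup-mono v (Linked.tail v↗) i≤j

  ↗↭↗⇒≡ : ∀ {xs ys} → Sorted ℤ.≤-totalOrder xs → Sorted ℤ.≤-totalOrder ys → xs ↭ ys → xs ≡ ys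
  ↗↭↗⇒≡ xs↗ ys↗ xs↭ys = Pointwise-≡⇒≡ (↗↭↗⇒≋ ℤ.≤-totalOrder xs↗ ys↗ (↭⇒↭ₛ xs↭ys))

  ↗↭↗⇒≡ᵥ : ∀ {m} {u v : Vec ℤ m} → Sorted ℤ.≤-totalOrder (toList u) → Sorted ℤ.≤-totalOrder (toList v) →
           toList u ↭ toList v → u ≡ v
  ↗↭↗⇒≡ᵥ {u = u} {v} u↗ v↗ u↭v = trans (sym (cast-is-id refl u)) (toList-injective refl u v (↗↭↗⇒≡ u↗ v↗ u↭v))

  module SortVec (O : DecTotalOrder 0ℓ 0ℓ 0ℓ) where
    open DecTotalOrder O using (Carrier; totalOrder)
    open Sort O using (sort; sort-↭; sort-↗) public

    sortVec : ∀ {m} (xs : List Carrier) → length xs ≡ m → Vec Carrier m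
    sortVec xs |xs|≡m = subst (Vec Carrier) (trans (↭.↭-length (sort-↭ xs)) |xs|≡m) (fromList (sort xs))

    toList-sortVec : ∀ {m} (xs : List Carrier) (|xs|≡m : length xs ≡ m) → toList (sortVec xs |xs|≡m) ≡ sort xs
    toList-sortVec xs |xs|≡m with trans (↭.↭-length (sort-↭ xs)) |xs|≡m
    ... | refl = toList∘fromList (sort xs)

  #<≡0 : ∀ {y e} xs → Sorted ℕ.≤-totalOrder (e ∷ xs) → y ℕ.≤ e → #< y (e ∷ xs) ≡ 0
  #<≡0 {y} {e} []        _          y≤e = cong (ℕ._+ 0) (𝟙-reject (e ℕ.<? y) (ℕ.≤⇒≯ y≤e))
  #<≡0 {y} {e} (e' ∷ xs) (e≤e' ∷ s) y≤e =
    cong₂ ℕ._+_ (𝟙-reject (e ℕ.<? y) (ℕ.≤⇒≯ y≤e)) (#<≡0 xs s (ℕ.≤-trans y≤e e≤e'))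

  ≤lookup⇒#<≤ : ∀ {m y} (E : Vec ℕ m) → Sorted ℕ.≤-totalOrder (toList E) →
                ∀ j → y ℕ.≤ lookup E j → #< y (toList E) ℕ.≤ toℕ j
  ≤lookup⇒#<≤ (e ∷ E) E↗ zero    y≤e = ℕ.≤-reflexive (#<≡0 (toList E) E↗ y≤e)
  ≤lookup⇒#<≤ {y = y} (e ∷ E) E↗ (suc j) y≤Eⱼ with e ℕ.<? y
  ... | yes _ = s≤s (≤lookup⇒#<≤ E (Linked.tail E↗) j y≤Eⱼ)
  ... | no _  = ℕ.m≤n⇒m≤1+n (≤lookup⇒#<≤ E (Linked.tail E↗) j y≤Eⱼ)

  #<≤⇒≤lookup : ∀ {m y} (E : Vec ℕ m) → Sorted ℕ.≤-totalOrder (toList E) →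
                ∀ j → #< y (toList E) ℕ.≤ toℕ j → y ℕ.≤ lookup E j
  #<≤⇒≤lookup {y = y} (e ∷ E) E↗ j #<≤j with e ℕ.<? y
  #<≤⇒≤lookup (e ∷ E) E↗ (suc j) (s≤s #<≤j) | yes _   = #<≤⇒≤lookup E (Linked.tail E↗) j #<≤j
  #<≤⇒≤lookup (e ∷ E) E↗ zero    _          | no e≮y = ℕ.≮⇒≥ e≮y
  #<≤⇒≤lookup (e ∷ E) E↗ (suc j) _          | no e≮y =
    ℕ.≤-trans (ℕ.≮⇒≥ e≮y) (lookup-mono ℕ.≤-totalOrder (e ∷ E) E↗ {zero} {suc j} z≤n)

module Offsets where

  open import Data.Nat
  open import Data.Nat.Properties
  open import Data.Nat.DivMod
  open import Data.Integer as ℤ using (ℤ)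
  import Data.Integer.Properties as ℤ
  open import Data.Fin as Fin using (Fin; toℕ; fromℕ; fromℕ<)
  import Data.Fin.Properties as Fin
  open import Data.List as List using (List)
  open import Data.List.Properties using (map-∘; map-id-local)
  open import Data.List.Relation.Unary.All as All using (All)
  import Data.List.Relation.Unary.All.Properties as All
  open import Data.Vec using (Vec; toList; lookup; map)
  open import Data.Vec.Properties using (lookup-map; length-toList)
  import Data.Vec.Relation.Unary.All as Vec
  import Data.Vec.Relation.Unary.All.Properties as Vec
  open import Data.List.Relation.Unary.Sorted.TotalOrder using (Sorted)
  open import Data.Product using (_,_; _×_; ∃-syntax)
  open import Relation.Nullary using (yes; no)
  open import Relation.Binary.PropositionalEquality
  open import Data.Integer.Tactic.RingSolver using (solve-∀)
  open import Defs using (IsQ; SCond)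
  open FiniteSums
  open Cycle using (#<; module Walks)
  open SortedVectors

  IsQ-suc-/ : ∀ r .{{_ : NonZero r}} ω → IsQ r (suc ω) (suc (ω / r))
  IsQ-suc-/ r ω = ω<[1+ω/r]*r , λ m 1+ω≤m*r → m<n*o⇒m/o<n 1+ω≤m*r
    where
    ω<[1+ω/r]*r : ω < suc (ω / r) * r
    ω<[1+ω/r]*r = subst (_< suc (ω / r) * r) (sym (m≡m%n+[m/n]*n ω r)) (+-monoˡ-< ((ω / r) * r) (m%n<n ω r))

  offset : ℕ → ℕ → ℤ
  offset ω e = ℤ.+ suc (ω + e)

  -- Condition (III); the index j here is the paper's j − 1.
  BelowDiagonal : ∀ {n} → ℕ → ℕ → Vec ℤ n → Set
  BelowDiagonal r w b = ∀ j → ℤ.+ w ℤ.< lookup b j → lookup b j ℤ.≤ ℤ.+ (toℕ j * r)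

  offset-diff : ∀ ω e → offset ω e ℤ.- ℤ.+ suc ω ≡ ℤ.+ e
  offset-diff ω e = trans (cong (ℤ._- ℤ.+ suc ω) (ℤ.pos-+ (suc ω) e)) (cancel (ℤ.+ suc ω) (ℤ.+ e))
    where
    cancel : ∀ a b → a ℤ.+ b ℤ.- a ≡ b
    cancel = solve-∀

  offset-∣∣∸-inverse : ∀ ω {z} → ℤ.+ suc ω ℤ.≤ z → offset ω (ℤ.∣ z ∣ ∸ suc ω) ≡ z
  offset-∣∣∸-inverse ω (ℤ.+≤+ 1+ω≤m) = cong ℤ.+_ (m+[n∸m]≡n 1+ω≤m)

  ∣∣∸1+ω<N : ∀ ω {N z y} → ℤ.+ suc ω ℤ.≤ z → z ℤ.≤ y → y ℤ.- ℤ.+ suc ω ℤ.< ℤ.+ N → ℤ.∣ z ∣ ∸ suc ω < N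
  ∣∣∸1+ω<N ω {N} (ℤ.+≤+ 1+ω≤m) (ℤ.+≤+ {n = M} m≤M) M-1-ω<N = ≤-<-trans (∸-monoˡ-≤ (suc ω) m≤M)
    (ℤ.drop‿+<+ (subst (ℤ._< ℤ.+ N) (trans (ℤ.m-n≡m⊖n M (suc ω)) (ℤ.⊖-≥ (≤-trans 1+ω≤m m≤M))) M-1-ω<N))

  module Encoding (N r k n₀ : ℕ) .{{_ : NonZero N}} .{{_ : NonZero r}} (N+k≡rn : N + k ≡ r * suc n₀) where

    n : ℕ
    n = suc n₀

    open Walks N r

    r*n-k≡N : ℤ.+ (r * n) ℤ.- ℤ.+ k ≡ ℤ.+ N
    r*n-k≡N = trans (cong (λ x → ℤ.+ x ℤ.- ℤ.+ k) (sym N+k≡rn))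
                    (trans (cong (ℤ._- ℤ.+ k) (ℤ.pos-+ N k)) (cancel (ℤ.+ N) (ℤ.+ k)))
      where
      cancel : ∀ a b → a ℤ.+ b ℤ.- b ≡ a
      cancel = solve-∀

    walk⇒ω/r<#<1 : ∀ ω xs → Walk (suc ω) xs → ω / r < #< 1 xs
    walk⇒ω/r<#<1 ω xs walk = m<n*o⇒m/o<n (subst (ω <_) (*-comm r (#< 1 xs)) (≤-trans (m≤m+n (suc ω) 1) (walk (>-nonZero⁻¹ N))))

    walk⇒lookup≡0 : ∀ ω (E : Vec ℕ n) → Sorted ≤-totalOrder (toList E) → Walk (suc ω) (toList E) →
                    ∀ j → toℕ j ≤ ω / r → lookup E j ≡ 0
    walk⇒lookup≡0 ω E E↗ walk j j≤ω/r = n<1⇒n≡0 (≰⇒> λ 1≤Eⱼ →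
      <⇒≱ (≤-<-trans j≤ω/r (walk⇒ω/r<#<1 ω (toList E) walk)) (≤lookup⇒#<≤ E E↗ j 1≤Eⱼ))

    walk⇒SCond : ∀ ω (E : Vec ℕ n) → Sorted ≤-totalOrder (toList E) → Vec.All (_< N) E → ω < k →
                 Walk (suc ω) (toList E) → SCond n r k (map (offset ω) E)
    walk⇒SCond ω E E↗ E<N ω<k walk =
        Fin.zero , refl , fromℕ n₀ , cong suc (Fin.toℕ-fromℕ n₀) , suc ω , s≤s z≤n , ω<k ,
        b≡1+ω Fin.zero z≤n , span ,
        (jq , subst (λ q → IsQ r (suc ω) (suc q)) (sym toℕ-jq) (IsQ-suc-/ r ω) , b≡1+ω jq (≤-reflexive toℕ-jq)) ,
        below
      where
      b = map (offset ω) E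
      q<n : ω / r < n
      q<n = <-≤-trans (walk⇒ω/r<#<1 ω (toList E) walk) (subst (#< 1 (toList E) ≤_) (length-toList E) (count≤length _ (toList E)))
      jq = fromℕ< q<n
      toℕ-jq : toℕ jq ≡ ω / r
      toℕ-jq = Fin.toℕ-fromℕ< q<n
      b≡1+ω : ∀ j → toℕ j ≤ ω / r → lookup b j ≡ ℤ.+ suc ω
      b≡1+ω j j≤ω/r = trans (lookup-map j (offset ω) E)
        (trans (cong (offset ω) (walk⇒lookup≡0 ω E E↗ walk j j≤ω/r)) (cong (λ x → ℤ.+ suc x) (+-identityʳ ω)))
      span : lookup b (fromℕ n₀) ℤ.- lookup b Fin.zero ℤ.< ℤ.+ (r * n) ℤ.- ℤ.+ k
      span = subst₂ ℤ._<_ (sym (trans (cong₂ ℤ._-_ (lookup-map (fromℕ n₀) (offset ω) E) (b≡1+ω Fin.zero z≤n))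
                                      (offset-diff ω (lookup E (fromℕ n₀)))))
                          (sym r*n-k≡N) (ℤ.+<+ (Vec.lookup⁺ E<N (fromℕ n₀)))
      below : BelowDiagonal r (suc ω) b
      below j 1+ω<bⱼ = subst (ℤ._≤ ℤ.+ (toℕ j * r)) (sym (lookup-map j (offset ω) E)) (ℤ.+≤+ (begin
        suc ω + e               ≡⟨ cong (suc ω +_) (sym (suc-pred e)) ⟩
        suc ω + suc (pred e)    ≤⟨ walk (≤-<-trans pred[n]≤n (Vec.lookup⁺ E<N j)) ⟩
        r * #< (suc (pred e)) (toList E) ≡⟨ cong (λ y → r * #< y (toList E)) (suc-pred e) ⟩
        r * #< e (toList E)     ≤⟨ *-monoʳ-≤ r (≤lookup⇒#<≤ E E↗ j ≤-refl) ⟩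
        r * toℕ j               ≡⟨ *-comm r (toℕ j) ⟩
        toℕ j * r               ∎))
        where
        open ≤-Reasoning
        e = lookup E j
        instance
          e≢0 : NonZero e
          e≢0 = >-nonZero (+-cancelˡ-< ω 0 e (subst (_< ω + e) (sym (+-identityʳ ω))
                  (s≤s⁻¹ (ℤ.drop‿+<+ (subst (ℤ.+ suc ω ℤ.<_) (lookup-map j (offset ω) E) 1+ω<bⱼ)))))

    belowDiagonal⇒walk : ∀ ω (E : Vec ℕ n) → Sorted ≤-totalOrder (toList E) → suc ω ≤ k →
                         BelowDiagonal r (suc ω) (map (offset ω) E) → Walk (suc ω) (toList E)
    belowDiagonal⇒walk ω E E↗ 1+ω≤k below {t} t<N with #< (suc t) (toList E) <? n
    ... | yes c<n = begin
      suc ω + suc t       ≤⟨ +-monoʳ-≤ (suc ω) 1+t≤Eⱼ ⟩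
      suc ω + lookup E j  ≤⟨ ℤ.drop‿+≤+ (subst (ℤ._≤ ℤ.+ (toℕ j * r)) (lookup-map j (offset ω) E) (below j 1+ω<bⱼ)) ⟩
      toℕ j * r           ≡⟨ cong (_* r) (Fin.toℕ-fromℕ< c<n) ⟩
      c * r               ≡⟨ *-comm c r ⟩
      r * c               ∎
      where
      open ≤-Reasoning
      c = #< (suc t) (toList E)
      j = fromℕ< c<n
      1+t≤Eⱼ : suc t ≤ lookup E j
      1+t≤Eⱼ = #<≤⇒≤lookup E E↗ j (≤-reflexive (sym (Fin.toℕ-fromℕ< c<n)))
      1+ω<bⱼ : ℤ.+ suc ω ℤ.< lookup (map (offset ω) E) j
      1+ω<bⱼ = subst (ℤ.+ suc ω ℤ.<_) (sym (lookup-map j (offset ω) E))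
                 (ℤ.+<+ (s≤s (subst (_≤ ω + lookup E j) (+-comm ω 1) (+-monoʳ-≤ ω (≤-trans (s≤s z≤n) 1+t≤Eⱼ)))))
    ... | no c≮n = begin
      suc ω + suc t       ≤⟨ +-mono-≤ 1+ω≤k t<N ⟩
      k + N               ≡⟨ trans (+-comm k N) N+k≡rn ⟩
      r * n               ≡⟨ cong (r *_) (≤-antisym c≤n (≮⇒≥ c≮n)) ⟨
      r * #< (suc t) (toList E) ∎
      where
      open ≤-Reasoning
      c≤n = subst (#< (suc t) (toList E) ≤_) (length-toList E) (count≤length _ (toList E))

    decode : ∀ ω (b : Vec ℤ n) → Sorted ℤ.≤-totalOrder (toList b) → ∀ {j₁ jₙ} → toℕ j₁ ≡ 0 → suc (toℕ jₙ) ≡ n →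
             lookup b j₁ ≡ ℤ.+ suc ω → lookup b jₙ ℤ.- lookup b j₁ ℤ.< ℤ.+ (r * n) ℤ.- ℤ.+ k →
             ∃[ Es ] All (_< N) Es × toList b ≡ List.map (offset ω) Es
    decode ω b b↗ {j₁} {jₙ} j₁≡0 1+jₙ≡n b₁≡1+ω span =
      List.map (λ z → ℤ.∣ z ∣ ∸ suc ω) (toList b) ,
      All.map⁺ (All.map (λ {(1+ω≤z , z≤bₙ) → ∣∣∸1+ω<N ω 1+ω≤z z≤bₙ span′}) window) ,
      sym (trans (sym (map-∘ (toList b))) (map-id-local (All.map (λ {(1+ω≤z , _) → offset-∣∣∸-inverse ω 1+ω≤z}) window)))
      where
      window : All (λ z → ℤ.+ suc ω ℤ.≤ z × z ℤ.≤ lookup b jₙ) (toList b)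
      window = Vec.toList⁺ (Vec.lookup⁻ λ j →
        subst (ℤ._≤ lookup b j) b₁≡1+ω (lookup-mono ℤ.≤-totalOrder b b↗ (subst (_≤ toℕ j) (sym j₁≡0) z≤n)) ,
        lookup-mono ℤ.≤-totalOrder b b↗ (s≤s⁻¹ (subst (suc (toℕ j) ≤_) (sym 1+jₙ≡n) (Fin.toℕ<n j))))
      span′ : lookup b jₙ ℤ.- ℤ.+ suc ω ℤ.< ℤ.+ N
      span′ = subst₂ (λ x y → lookup b jₙ ℤ.- x ℤ.< y) b₁≡1+ω r*n-k≡N span

module Orbits where

  open import Data.Nat
  open import Data.Nat.Properties
  open import Data.Nat.DivMod
  open import Data.List using (List)
  open import Data.List.Relation.Binary.Permutation.Propositional using (_↭_; ↭-sym; ↭-trans; ↭-reflexive)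
  import Data.List.Relation.Binary.Permutation.Propositional.Properties as ↭
  open import Data.Sum using (inj₁; inj₂)
  open import Relation.Nullary using (¬_; contradiction)
  open import Relation.Binary.PropositionalEquality
  open ResidueShifts
  open import Algebra.Properties.CommutativeSemigroup +-commutativeSemigroup using (xy∙z≈y∙xz)

  module Orbit (N : ℕ) .{{_ : NonZero N}} (xs : List ℕ) (p : ℕ) .{{_ : NonZero p}}
               (periodic : Residues.rot N p xs ↭ Residues.rot N 0 xs)
               (minimal : ∀ i → 1 ≤ i → i < p → ¬ (Residues.rot N i xs ↭ Residues.rot N 0 xs)) where

    open Residues N

    rot-↭-+ : ∀ {i i'} c → rot i xs ↭ rot i' xs → rot (i + c) xs ↭ rot (i' + c) xs
    rot-↭-+ {i} {i'} c rotᵢ↭rotᵢ' = subst₂ _↭_ (rot-rot i c xs) (rot-rot i' c xs) (↭.map⁺ _ rotᵢ↭rotᵢ')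

    rot-+p : ∀ i → rot (p + i) xs ↭ rot i xs
    rot-+p i = rot-↭-+ i periodic

    rot-*p : ∀ c i → rot (c * p + i) xs ↭ rot i xs
    rot-*p zero    i = ↭-reflexive refl
    rot-*p (suc c) i = ↭-trans (↭-reflexive (cong (λ x → rot x xs) (+-assoc p (c * p) i)))
                               (↭-trans (rot-+p (c * p + i)) (rot-*p c i))

    rot-%p : ∀ i → rot i xs ↭ rot (i % p) xs
    rot-%p i = ↭-trans (↭-reflexive (cong (λ x → rot x xs) (trans (m≡m%n+[m/n]*n i p) (+-comm (i % p) _))))
                       (rot-*p (i / p) (i % p))

    <p-aperiodic : ∀ {d} → d < p → rot d xs ↭ rot 0 xs → d ≡ 0
    <p-aperiodic {zero}  _   _        = refl
    <p-aperiodic {suc d} d<p periodic = contradiction periodic (minimal (suc d) (s≤s z≤n) d<p)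

    p∣N : N % p ≡ 0
    p∣N = <p-aperiodic (m%n<n N p) (↭-trans (↭-sym (rot-%p N)) (↭-reflexive (rot-+N 0 xs)))

    p≤N : p ≤ N
    p≤N = ≮⇒≥ λ N<p → minimal N (>-nonZero⁻¹ N) N<p (↭-reflexive (rot-+N 0 xs))

    shift-within-period≡ : ∀ {j j'} → j ≤ j' → j' < p → rot j' xs ↭ rot j xs → j' ≡ j
    shift-within-period≡ {j} {j'} j≤j' j'<p rotⱼ'↭rotⱼ = begin
      j'            ≡⟨ m+[n∸m]≡n j≤j' ⟨
      j + d         ≡⟨ cong (j +_) (<p-aperiodic (≤-<-trans (m∸n≤m j' j) j'<p) rot-d↭rot-0) ⟩
      j + 0         ≡⟨ +-identityʳ j ⟩
      j             ∎
      where
      open ≡-Reasoning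
      d = j' ∸ j
      j≤N : j ≤ N
      j≤N = ≤-trans j≤j' (≤-trans (<⇒≤ j'<p) p≤N)
      rot-d↭rot-0 : rot d xs ↭ rot 0 xs
      rot-d↭rot-0 = subst₂ _↭_ (trans (cong (λ x → rot x xs) j'+[N∸j]≡d+N) (rot-+N d xs))
                               (trans (cong (λ x → rot x xs) (m+[n∸m]≡n j≤N)) (rot-+N 0 xs))
                               (rot-↭-+ (N ∸ j) rotⱼ'↭rotⱼ)
        where
        j'+[N∸j]≡d+N : j' + (N ∸ j) ≡ d + N
        j'+[N∸j]≡d+N = begin
          j' + (N ∸ j)         ≡⟨ cong (_+ (N ∸ j)) (m+[n∸m]≡n j≤j') ⟨
          j + d + (N ∸ j)      ≡⟨ xy∙z≈y∙xz j d (N ∸ j) ⟩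
          d + (j + (N ∸ j))    ≡⟨ cong (d +_) (m+[n∸m]≡n j≤N) ⟩
          d + N                ∎

    rot-injective : ∀ {i i'} → i < p → i' < p → rot i xs ↭ rot i' xs → i ≡ i'
    rot-injective {i} {i'} i<p i'<p rotᵢ↭rotᵢ' with ≤-total i i'
    ... | inj₁ i≤i' = sym (shift-within-period≡ i≤i' i'<p (↭-sym rotᵢ↭rotᵢ'))
    ... | inj₂ i'≤i = shift-within-period≡ i'≤i i<p rotᵢ↭rotᵢ'

module Enumeration where

  open import Level using (Level)
  open import Data.Nat
  open import Data.Nat.Properties
  open import Data.List using (List; []; _∷_; _++_; [_]; length)
  open import Data.List.Properties using (length-++)
  open import Data.List.Membership.Propositional using (_∈_)
  open import Data.List.Membership.Propositional.Properties using (∈-++⁺ˡ; ∈-++⁺ʳ; ∈-++⁻)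
  open import Data.List.Relation.Unary.Any using (here)
  open import Data.List.Relation.Unary.Unique.Propositional using (Unique)
  import Data.List.Relation.Unary.Unique.Propositional.Properties as Unique
  import Data.List.Relation.Unary.AllPairs as AllPairs
  import Data.List.Relation.Unary.All as All
  open import Data.Product using (∃-syntax; _×_; _,_; proj₁; proj₂)
  open import Data.Sum using (inj₁; inj₂)
  open import Relation.Nullary using (Dec; yes; no; ¬_; contradiction)
  open import Relation.Binary.PropositionalEquality hiding ([_])
  open FiniteSums

  private variable
    a : Level
    A : Set a

  concatUpTo : ℕ → (ℕ → List A) → List A
  concatUpTo zero    f = []
  concatUpTo (suc m) f = concatUpTo m f ++ f m

  length-concatUpTo : ∀ m (f : ℕ → List A) → length (concatUpTo m f) ≡ ∑[ i < m ] length (f i)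
  length-concatUpTo zero    f = refl
  length-concatUpTo (suc m) f = trans (length-++ (concatUpTo m f)) (cong (_+ length (f m)) (length-concatUpTo m f))

  ∈-concatUpTo⁻ : ∀ m (f : ℕ → List A) {x} → x ∈ concatUpTo m f → ∃[ i ] i < m × x ∈ f i
  ∈-concatUpTo⁻ (suc m) f x∈ with ∈-++⁻ (concatUpTo m f) x∈
  ... | inj₁ x∈fs with ∈-concatUpTo⁻ m f x∈fs
  ...   | i , i<m , x∈fᵢ = i , m<n⇒m<1+n i<m , x∈fᵢ
  ∈-concatUpTo⁻ (suc m) f x∈ | inj₂ x∈fₘ = m , ≤-refl , x∈fₘ

  ∈-concatUpTo⁺ : ∀ m (f : ℕ → List A) {x i} → i < m → x ∈ f i → x ∈ concatUpTo m f
  ∈-concatUpTo⁺ (suc m) f i<1+m x∈fᵢ with m≤n⇒m<n∨m≡n (s≤s⁻¹ i<1+m)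
  ... | inj₁ i<m  = ∈-++⁺ˡ (∈-concatUpTo⁺ m f i<m x∈fᵢ)
  ... | inj₂ refl = ∈-++⁺ʳ (concatUpTo m f) x∈fᵢ

  unique-concatUpTo : ∀ m (f : ℕ → List A) → (∀ {i} → i < m → Unique (f i)) →
                      (∀ {i i' x} → i < m → i' < m → x ∈ f i → x ∈ f i' → i ≡ i') → Unique (concatUpTo m f)
  unique-concatUpTo zero    f unique disjoint = AllPairs.[]
  unique-concatUpTo (suc m) f unique disjoint = Unique.++⁺
    (unique-concatUpTo m f (λ i<m → unique (m<n⇒m<1+n i<m)) (λ i<m i'<m → disjoint (m<n⇒m<1+n i<m) (m<n⇒m<1+n i'<m)))
    (unique ≤-refl) apart
    where
    apart : ∀ {x} → ¬ (x ∈ concatUpTo m f × x ∈ f m)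
    apart (x∈fs , x∈fₘ) with ∈-concatUpTo⁻ m f x∈fs
    ... | i , i<m , x∈fᵢ = <-irrefl (disjoint (m<n⇒m<1+n i<m) ≤-refl x∈fᵢ x∈fₘ) i<m

  singletonIf : {P : Set} → Dec P → A → List A
  singletonIf (yes _) x = [ x ]
  singletonIf (no _)  x = []

  length-singletonIf : {P : Set} (P? : Dec P) (x : A) → length (singletonIf P? x) ≡ 𝟙 P?
  length-singletonIf (yes _) x = refl
  length-singletonIf (no _)  x = refl

  ∈-singletonIf⁻ : {P : Set} (P? : Dec P) {x y : A} → x ∈ singletonIf P? y → P × x ≡ y
  ∈-singletonIf⁻ (yes p) (here x≡y) = p , x≡y

  ∈-singletonIf⁺ : {P : Set} (P? : Dec P) {y : A} → P → y ∈ singletonIf P? y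
  ∈-singletonIf⁺ (yes _) _ = here refl
  ∈-singletonIf⁺ (no ¬p) p = contradiction p ¬p

  unique-singletonIf : {P : Set} (P? : Dec P) (y : A) → Unique (singletonIf P? y)
  unique-singletonIf (yes _) y = All.[] AllPairs.∷ AllPairs.[]
  unique-singletonIf (no _)  y = AllPairs.[]

  module _ {P : ℕ → ℕ → Set} (P? : ∀ i j → Dec (P i j)) (f : ℕ → ℕ → A) where

    filteredPairs : ℕ → ℕ → List A
    filteredPairs p k = concatUpTo p λ i → concatUpTo k λ j → singletonIf (P? i j) (f i j)

    length-filteredPairs : ∀ p k → length (filteredPairs p k) ≡ ∑[ i < p ] ∑[ j < k ] 𝟙 (P? i j)
    length-filteredPairs p k = trans (length-concatUpTo p _) (∑<-cong p λ i _ →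
      trans (length-concatUpTo k _) (∑<-cong k λ j _ → length-singletonIf (P? i j) (f i j)))

    ∈-filteredPairs⁻ : ∀ p k {x} → x ∈ filteredPairs p k → ∃[ i ] ∃[ j ] i < p × j < k × P i j × x ≡ f i j
    ∈-filteredPairs⁻ p k x∈ with ∈-concatUpTo⁻ p _ x∈
    ... | i , i<p , x∈ᵢ with ∈-concatUpTo⁻ k _ x∈ᵢ
    ...   | j , j<k , x∈ᵢⱼ with ∈-singletonIf⁻ (P? i j) x∈ᵢⱼ
    ...     | Pᵢⱼ , x≡fᵢⱼ = i , j , i<p , j<k , Pᵢⱼ , x≡fᵢⱼ

    ∈-filteredPairs⁺ : ∀ p k {i j} → i < p → j < k → P i j → f i j ∈ filteredPairs p k
    ∈-filteredPairs⁺ p k {i} {j} i<p j<k Pᵢⱼ =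
      ∈-concatUpTo⁺ p _ i<p (∈-concatUpTo⁺ k _ j<k (∈-singletonIf⁺ (P? i j) Pᵢⱼ))

    unique-filteredPairs : ∀ p k → (∀ {i j i' j'} → i < p → i' < p → P i j → P i' j' → f i j ≡ f i' j' → i ≡ i' × j ≡ j') →
                           Unique (filteredPairs p k)
    unique-filteredPairs p k injective = unique-concatUpTo p _
      (λ {i} i<p → unique-concatUpTo k _ (λ {j} _ → unique-singletonIf (P? i j) (f i j))
         λ _ _ x∈ᵢⱼ x∈ᵢⱼ' → proj₂ (same-index i<p i<p x∈ᵢⱼ x∈ᵢⱼ'))
      λ i<p i'<p x∈ᵢ x∈ᵢ' → same-row i<p i'<p (∈-concatUpTo⁻ k _ x∈ᵢ) (∈-concatUpTo⁻ k _ x∈ᵢ')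
      where
      same-index : ∀ {i i' j j' x} → i < p → i' < p → x ∈ singletonIf (P? i j) (f i j) →
                   x ∈ singletonIf (P? i' j') (f i' j') → i ≡ i' × j ≡ j'
      same-index {i} {i'} {j} {j'} i<p i'<p x∈ x∈' with ∈-singletonIf⁻ (P? i j) x∈ | ∈-singletonIf⁻ (P? i' j') x∈'
      ... | Pᵢⱼ , refl | Pᵢ'ⱼ' , x≡fᵢ'ⱼ' = injective i<p i'<p Pᵢⱼ Pᵢ'ⱼ' x≡fᵢ'ⱼ'
      same-row : ∀ {i i' x} → i < p → i' < p →
                 ∃[ j ] j < k × x ∈ singletonIf (P? i j) (f i j) → ∃[ j' ] j' < k × x ∈ singletonIf (P? i' j') (f i' j') → i ≡ i'
      same-row i<p i'<p (_ , _ , x∈ᵢⱼ) (_ , _ , x∈ᵢ'ⱼ') = proj₁ (same-index i<p i'<p x∈ᵢⱼ x∈ᵢ'ⱼ')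

module Counting where

  open import Function using (_∘_)
  open import Function.Bundles using (_⇔_; mk⇔)
  open import Data.Nat
  open import Data.Nat.Properties
  open import Data.Nat.DivMod
  open import Data.Integer as ℤ using (ℤ)
  import Data.Integer.Properties as ℤ
  import Data.Fin as Fin
  open import Data.List as List using (List; length)
  open import Data.List.Properties using (map-∘; map-cong; map-id-local; length-map)
  open import Data.List.Relation.Unary.All as All using (All)
  import Data.List.Relation.Unary.All.Properties as All
  open import Data.Vec as Vec using (Vec; toList; lookup)
  open import Data.Vec.Properties using (toList-map; length-toList; lookup-map)
  import Data.Vec.Relation.Unary.All as VecAll
  import Data.Vec.Relation.Unary.All.Properties as VecAll
  open import Data.List.Relation.Binary.Permutation.Propositional
    using (_↭_; ↭-sym; ↭-trans; ↭-reflexive; ↭-refl; module PermutationReasoning)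
  import Data.List.Relation.Binary.Permutation.Propositional.Properties as ↭
  open import Data.List.Relation.Unary.Sorted.TotalOrder using (Sorted)
  import Data.List.Relation.Unary.Sorted.TotalOrder.Properties as Sorted
  open import Data.List.Membership.Propositional using (_∈_)
  open import Data.List.Relation.Unary.Unique.Propositional using (Unique)
  open import Data.Product using (Σ; ∃-syntax; _×_; _,_; proj₁; proj₂)
  open import Relation.Nullary using (¬_; Dec)
  open import Relation.Binary.PropositionalEquality
  open import Defs
  open FiniteSums
  open ResidueShifts
  open Cycle
  open SortedVectors
  open Offsets
  open Orbits
  open Enumeration

  ι : ℕ → ℤ
  ι x = ℤ.+ suc x

  map-ι-↭⁻ : ∀ {xs ys} → List.map ι xs ↭ List.map ι ys → xs ↭ ys
  map-ι-↭⁻ {xs} {ys} ιxs↭ιys = subst₂ _↭_ (ι⁻¹∘ι xs) (ι⁻¹∘ι ys) (↭.map⁺ (λ z → ℤ.∣ z ∣ ∸ 1) ιxs↭ιys)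
    where
    ι⁻¹∘ι : ∀ xs → List.map (λ z → ℤ.∣ z ∣ ∸ 1) (List.map ι xs) ≡ xs
    ι⁻¹∘ι xs = trans (sym (map-∘ xs)) (map-id-local (All.tabulate λ _ → refl))

  module ℤ-sort = SortVec ℤ.≤-decTotalOrder

  incRearr : ∀ {m} (v : Vec ℤ m) → IsIncRearr v (ℤ-sort.sortVec (toList v) (length-toList v))
  incRearr v = subst (Sorted ℤ.≤-totalOrder) (sym toList-sorted) (ℤ-sort.sort-↗ (toList v)) ,
               subst (_↭ toList v) (sym toList-sorted) (ℤ-sort.sort-↭ (toList v))
    where
    toList-sorted = ℤ-sort.toList-sortVec (toList v) (length-toList v)

  module Setup (N r k n₀ : ℕ) .{{_ : NonZero N}} .{{_ : NonZero r}} (N+k≡rn : N + k ≡ r * suc n₀)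
              (a : Vec ℤ (suc n₀)) (a∈[1,N] : VecAll.All (λ x → (ℤ.+ 1 ℤ.≤ x) × (x ℤ.≤ ℤ.+ N)) a) where

    open Residues N
    open Walks N r
    open Encoding N r k n₀ N+k≡rn
    module ℕ-sort = SortVec ≤-decTotalOrder

    αs : List ℕ
    αs = List.map (λ x → ℤ.∣ x ∣ ∸ 1) (toList a)

    private
      a∈[1,N]′ : All (λ x → (ℤ.+ 1 ℤ.≤ x) × (x ℤ.≤ ℤ.+ N)) (toList a)
      a∈[1,N]′ = VecAll.toList⁺ a∈[1,N]

    toList-a : toList a ≡ List.map ι αs
    toList-a = trans (sym (map-id-local (All.map ι∘ι⁻¹ a∈[1,N]′))) (map-∘ (toList a))
      where
      ι∘ι⁻¹ : ∀ {x} → (ℤ.+ 1 ℤ.≤ x) × (x ℤ.≤ ℤ.+ N) → ι (ℤ.∣ x ∣ ∸ 1) ≡ x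
      ι∘ι⁻¹ (ℤ.+≤+ (s≤s z≤n) , _) = refl

    αs<N : All (_< N) αs
    αs<N = All.map⁺ (All.map ι⁻¹<N a∈[1,N]′)
      where
      ι⁻¹<N : ∀ {x} → (ℤ.+ 1 ℤ.≤ x) × (x ℤ.≤ ℤ.+ N) → ℤ.∣ x ∣ ∸ 1 < N
      ι⁻¹<N (ℤ.+≤+ (s≤s z≤n) , ℤ.+≤+ x≤N) = x≤N

    |αs|≡n : length αs ≡ n
    |αs|≡n = trans (length-map _ (toList a)) (length-toList a)

    md : ℤ → ℤ
    md x = (x ℤ.+ ℤ.+ 0) mod⁺ N

    map-md-offset : ∀ ω xs → List.map md (List.map (offset ω) xs) ≡ List.map ι (rot ω xs)
    map-md-offset ω xs = trans (sym (map-∘ xs)) (trans (map-cong (λ e → trans (mod⁺≡ (offset ω e ℤ.+ ℤ.+ 0))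
                           (cong (λ x → ℤ.+ suc (x % N)) (trans (+-identityʳ (ω + e)) (+-comm ω e)))) xs) (map-∘ xs))

    toList-shiftMod-≗ : ∀ {i i′} → (∀ α → (ι α ℤ.+ i) mod⁺ N ≡ ι ((α + i′) % N)) →
                        toList (shiftMod a i N) ≡ List.map ι (rot i′ αs)
    toList-shiftMod-≗ shift≗ = trans (toList-map _ a) (trans (cong (List.map _) toList-a)
                                 (trans (sym (map-∘ αs)) (trans (map-cong shift≗ αs) (map-∘ αs))))

    toList-shiftMod : ∀ i → toList (shiftMod a (ℤ.+ i) N) ≡ List.map ι (rot i αs)
    toList-shiftMod i = toList-shiftMod-≗ λ α → mod⁺≡ (ι α ℤ.+ ℤ.+ i)

    shiftMod-natural : ∀ i → ∃[ i′ ] toList (shiftMod a i N) ≡ List.map ι (rot i′ αs)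
    shiftMod-natural i with shift-natural i
    ... | i′ , shift≗ = i′ , toList-shiftMod-≗ shift≗

    sameIncRearr⇒↭ : ∀ {i} → SameIncRearr a (shiftMod a (ℤ.+ i) N) → rot i αs ↭ rot 0 αs
    sameIncRearr⇒↭ {i} (c , (_ , c↭a) , (_ , c↭shift)) = map-ι-↭⁻ (subst₂ _↭_
      (toList-shiftMod i) (trans toList-a (cong (List.map ι) (sym (rot-0 αs<N)))) (↭-trans (↭-sym c↭shift) c↭a))

    ↭⇒sameIncRearr : ∀ {i} → rot i αs ↭ rot 0 αs → SameIncRearr a (shiftMod a (ℤ.+ i) N)
    ↭⇒sameIncRearr {i} rotᵢ↭rot₀ = _ , (c↗ , c↭a) , (c↗ , ↭-trans c↭a a↭shift)
      where
      c↗ = proj₁ (incRearr a)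
      c↭a = proj₂ (incRearr a)
      a↭shift : toList a ↭ toList (shiftMod a (ℤ.+ i) N)
      a↭shift = subst₂ _↭_ (trans (cong (List.map ι) (rot-0 αs<N)) (sym toList-a)) (sym (toList-shiftMod i))
                  (↭.map⁺ ι (↭-sym rotᵢ↭rot₀))

    -- Defs.Counted with the modulus r * n ∸ k abstracted to N; the two agree once N is instantiated.
    Counted′ : Vec ℤ n → Set
    Counted′ b = Sorted ℤ.≤-totalOrder (toList b) × InS n r k b × ∃[ c ] (IsIncRearr (vecMod b N) c × InR N a c)

    counted⁻ : ∀ {b} → Counted′ b → SCond n r k b × ∃[ i ] toList (vecMod b N) ↭ List.map ι (rot i αs)
    counted⁻ {b} (b↗ , (c , (c↗ , c↭b) , sc) , (c′ , (_ , c′↭b) , (i , (_ , c′↭shift)))) with shiftMod-natural i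
    ... | i′ , toList-shift = subst (SCond n r k) c≡b sc , i′ , subst (_ ↭_) toList-shift (↭-trans (↭-sym c′↭b) c′↭shift)
      where
      c≡b : c ≡ b
      c≡b = ↗↭↗⇒≡ᵥ c↗ b↗ c↭b

    counted⁺ : ∀ {b} → Sorted ℤ.≤-totalOrder (toList b) → SCond n r k b →
               ∀ i → toList (vecMod b N) ↭ List.map ι (rot i αs) → Counted′ b
    counted⁺ {b} b↗ sc i vecMod-b↭ =
      b↗ , (b , (b↗ , ↭-refl) , sc) , (_ , incRearr (vecMod b N) , (ℤ.+ i , (c↗ , ↭-trans c↭vecMod-b vecMod-b↭′)))
      where
      c↗ = proj₁ (incRearr (vecMod b N))
      c↭vecMod-b = proj₂ (incRearr (vecMod b N))
      vecMod-b↭′ = subst (_ ↭_) (sym (toList-shiftMod i)) vecMod-b↭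

    module WithPeriod (p : ℕ) .{{_ : NonZero p}}
                      (periodic : SameIncRearr a (shiftMod a (ℤ.+ p) N))
                      (minimal : ∀ i → 1 ≤ i → i < p → ¬ SameIncRearr a (shiftMod a (ℤ.+ i) N)) where

      open Orbit N αs p (sameIncRearr⇒↭ periodic) (λ i 1≤i i<p → minimal i 1≤i i<p ∘ ↭⇒sameIncRearr)

      -- The residues α + i − ω mod N (pred N * ω acts as −ω): for shift i and b₁ = ω + 1 they are b − b₁.
      residues : ℕ → ℕ → List ℕ
      residues i ω = rot (i + pred N * ω) αs

      E : ℕ → ℕ → Vec ℕ n
      E i ω = ℕ-sort.sortVec (residues i ω) (trans (length-map _ αs) |αs|≡n)

      toList-E : ∀ i ω → toList (E i ω) ≡ ℕ-sort.sort (residues i ω)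
      toList-E i ω = ℕ-sort.toList-sortVec (residues i ω) _

      E↗ : ∀ i ω → Sorted ≤-totalOrder (toList (E i ω))
      E↗ i ω = subst (Sorted ≤-totalOrder) (sym (toList-E i ω)) (ℕ-sort.sort-↗ _)

      E↭ : ∀ i ω → toList (E i ω) ↭ residues i ω
      E↭ i ω = subst (_↭ residues i ω) (sym (toList-E i ω)) (ℕ-sort.sort-↭ _)

      E<N : ∀ i ω → VecAll.All (_< N) (E i ω)
      E<N i ω = VecAll.toList⁻ (↭.All-resp-↭ (↭-sym (E↭ i ω)) (All.map⁺ (All.tabulate λ {x} _ → m%n<n (x + (i + pred N * ω)) N)))

      β : ℕ → ℕ → Vec ℤ n
      β i ω = Vec.map (offset ω) (E i ω)

      β↗ : ∀ i ω → Sorted ℤ.≤-totalOrder (toList (β i ω))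
      β↗ i ω = subst (Sorted ℤ.≤-totalOrder) (sym (toList-map (offset ω) (E i ω)))
                 (Sorted.map⁺ ≤-totalOrder ℤ.≤-totalOrder (λ x≤y → ℤ.+≤+ (s≤s (+-monoʳ-≤ ω x≤y))) (E↗ i ω))

      vecMod-β : ∀ i ω → toList (vecMod (β i ω) N) ↭ List.map ι (rot i αs)
      vecMod-β i ω = begin
        toList (vecMod (β i ω) N)                          ≡⟨ toList-map md (β i ω) ⟩
        List.map md (toList (β i ω))                       ≡⟨ cong (List.map md) (toList-map (offset ω) (E i ω)) ⟩
        List.map md (List.map (offset ω) (toList (E i ω))) ≡⟨ map-md-offset ω (toList (E i ω)) ⟩
        List.map ι (rot ω (toList (E i ω)))                ↭⟨ ↭.map⁺ ι (↭.map⁺ _ (E↭ i ω)) ⟩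
        List.map ι (rot ω (residues i ω))                  ≡⟨ cong (List.map ι) (rot-rot (i + pred N * ω) ω αs) ⟩
        List.map ι (rot (i + pred N * ω + ω) αs)           ≡⟨ cong (λ m → List.map ι (rot m αs)) shift≡ ⟩
        List.map ι (rot (i + ω * N) αs)                    ≡⟨ cong (List.map ι) (rot-+* i ω αs) ⟩
        List.map ι (rot i αs)                              ∎
        where
        open PermutationReasoning
        shift≡ : i + pred N * ω + ω ≡ i + ω * N
        shift≡ = trans (+-assoc i (pred N * ω) ω) (cong (i +_) (trans (+-comm (pred N * ω) ω)
                   (trans (cong (_* ω) (suc-pred N)) (*-comm N ω))))

      good? : ∀ i ω → Dec (Walk (suc ω) (residues i ω))
      good? i ω = walk? (suc ω) (residues i ω)

      β-counted : ∀ {i ω} → ω < k → Walk (suc ω) (residues i ω) → Counted′ (β i ω)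
      β-counted {i} {ω} ω<k walk = counted⁺ (β↗ i ω)
        (walk⇒SCond ω (E i ω) (E↗ i ω) (E<N i ω) ω<k (walk-↭ {suc ω} (↭-sym (E↭ i ω)) walk)) i (vecMod-β i ω)

      β-injective : ∀ {i ω i′ ω′} → i < p → i′ < p → Walk (suc ω) (residues i ω) → Walk (suc ω′) (residues i′ ω′) →
                    β i ω ≡ β i′ ω′ → i ≡ i′ × ω ≡ ω′
      β-injective {i} {ω} {i′} {ω′} i<p i′<p walk walk′ β≡β′ =
        rot-injective i<p i′<p (map-ι-↭⁻ (↭-trans (↭-sym (vecMod-β i ω))
                                           (subst (λ b → toList (vecMod b N) ↭ _) (sym β≡β′) (vecMod-β i′ ω′)))) ,
        ω≡ω′
        where
        head : ∀ {i ω} → Walk (suc ω) (residues i ω) → lookup (β i ω) Fin.zero ≡ offset ω 0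
        head {i} {ω} walk = trans (lookup-map Fin.zero (offset ω) (E i ω))
          (cong (offset ω) (walk⇒lookup≡0 ω (E i ω) (E↗ i ω) (walk-↭ {suc ω} (↭-sym (E↭ i ω)) walk) Fin.zero z≤n))
        ω≡ω′ : ω ≡ ω′
        ω≡ω′ = +-cancelʳ-≡ 0 ω ω′ (suc-injective (ℤ.+-injective
                 (trans (sym (head walk)) (trans (cong (λ b → lookup b Fin.zero) β≡β′) (head walk′)))))

      counted-β : ∀ {b} → Counted′ b → ∃[ i ] ∃[ ω ] i < p × ω < k × Walk (suc ω) (residues i ω) × b ≡ β i ω
      counted-β {b} counted@(b↗ , _) with counted⁻ counted
      ... | (_ , _ , _ , _ , zero , () , _) , _
      ... | (j₁ , j₁≡0 , jₙ , 1+jₙ≡n , suc ω , _ , 1+ω≤k , b₁≡1+ω , span , _ , below) , i , vecMod-b↭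
          with decode ω b b↗ j₁≡0 1+jₙ≡n b₁≡1+ω span
      ...   | Es , Es<N , b≡Es = i % p , ω , m%n<n i p , 1+ω≤k , walk , b≡β
        where
        open PermutationReasoning
        Es↭ : Es ↭ residues (i % p) ω
        Es↭ = begin
          Es                                  ≡⟨ rot-inverse ω Es<N ⟨
          rot (pred N * ω) (rot ω Es)         ↭⟨ ↭.map⁺ _ (map-ι-↭⁻ (subst (_↭ List.map ι (rot i αs)) vecMod-b vecMod-b↭)) ⟩
          rot (pred N * ω) (rot i αs)         ≡⟨ rot-rot i (pred N * ω) αs ⟩
          residues i ω                        ↭⟨ rot-↭-+ (pred N * ω) (rot-%p i) ⟩
          residues (i % p) ω                  ∎
          where
          vecMod-b : toList (vecMod b N) ≡ List.map ι (rot ω Es)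
          vecMod-b = trans (toList-map md b) (trans (cong (List.map md) b≡Es) (map-md-offset ω Es))
        b≡β : b ≡ β (i % p) ω
        b≡β = ↗↭↗⇒≡ᵥ b↗ (β↗ (i % p) ω) (begin
          toList b                                   ≡⟨ b≡Es ⟩
          List.map (offset ω) Es                     ↭⟨ ↭.map⁺ (offset ω) (↭-trans Es↭ (↭-sym (E↭ (i % p) ω))) ⟩
          List.map (offset ω) (toList (E (i % p) ω)) ≡⟨ toList-map (offset ω) (E (i % p) ω) ⟨
          toList (β (i % p) ω)                       ∎)
        walk : Walk (suc ω) (residues (i % p) ω)
        walk = walk-↭ {suc ω} (E↭ (i % p) ω) (belowDiagonal⇒walk ω (E (i % p) ω) (E↗ (i % p) ω) 1+ω≤k
                 (subst (BelowDiagonal r (suc ω)) b≡β below))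

      #good : ℕ → ℕ
      #good i = ∑[ ω < k ] 𝟙 (good? i ω)

      #good-periodic : ∀ i → #good (p + i) ≡ #good i
      #good-periodic i = ∑<-cong k λ ω _ → 𝟙-cong _ _ (walk-↭ {suc ω} (shift ω)) (walk-↭ {suc ω} (↭-sym (shift ω)))
        where
        shift : ∀ ω → residues (p + i) ω ↭ residues i ω
        shift ω = ↭-trans (↭-reflexive (cong (λ m → rot m αs) (+-assoc p i (pred N * ω)))) (rot-+p (i + pred N * ω))

      ∑#good*N≡p*k : ∑< p #good * N ≡ p * k
      ∑#good*N≡p*k = begin
        ∑< p #good * N              ≡⟨ cong (∑< p #good *_) N≡N/p*p ⟩
        ∑< p #good * (N / p * p)    ≡⟨ *-assoc (∑< p #good) (N / p) p ⟨
        ∑< p #good * (N / p) * p    ≡⟨ cong (_* p) (*-comm (∑< p #good) (N / p)) ⟩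
        N / p * ∑< p #good * p      ≡⟨ cong (_* p) (∑<-periodic (N / p) p #good #good-periodic) ⟨
        ∑< (N / p * p) #good * p    ≡⟨ cong (λ m → ∑< m #good * p) N≡N/p*p ⟨
        ∑< N #good * p              ≡⟨ cong (_* p) (CycleLemma.cycle-lemma N r k n N+k≡rn αs |αs|≡n (pred N *_)) ⟩
        k * p                       ≡⟨ *-comm k p ⟩
        p * k                       ∎
        where
        open ≡-Reasoning
        N≡N/p*p : N ≡ N / p * p
        N≡N/p*p = trans (m≡m%n+[m/n]*n N p) (cong (_+ N / p * p) p∣N)

      counted-list : Σ (List (Vec ℤ n)) λ L → Unique L × (∀ b → (b ∈ L) ⇔ Counted′ b) × (length L * N ≡ p * k)
      counted-list = L , unique-filteredPairs good? β p k β-injective , (λ b → mk⇔ ∈L⇒counted counted⇒∈L) ,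
                     trans (cong (_* N) (length-filteredPairs good? β p k)) ∑#good*N≡p*k
        where
        L = filteredPairs good? β p k
        ∈L⇒counted : ∀ {b} → b ∈ L → Counted′ b
        ∈L⇒counted b∈L with ∈-filteredPairs⁻ good? β p k b∈L
        ... | _ , _ , _ , ω<k , walk , refl = β-counted ω<k walk
        counted⇒∈L : ∀ {b} → Counted′ b → b ∈ L
        counted⇒∈L counted with counted-β counted
        ... | _ , _ , i<p , ω<k , walk , refl = ∈-filteredPairs⁺ good? β p k i<p ω<k walk

open import Defs
open import Data.Nat using (ℕ; suc; _*_; _∸_; _≤_; _<_; NonZero; >-nonZero)
open import Data.Nat.Properties using (m∸n+n≡m; <⇒≤; m<n⇒0<n∸m)
open import Data.Integer as ℤ using (ℤ)
open import Data.Vec using (Vec)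
open import Data.Vec.Relation.Unary.All using (All)
open import Data.List using (List; length)
open import Data.List.Relation.Unary.Unique.Propositional using (Unique)
open import Data.List.Membership.Propositional using (_∈_)
open import Data.Product using (Σ; _×_)
open import Function.Bundles using (_⇔_)
open import Relation.Binary.PropositionalEquality using (_≡_)
open import Relation.Nullary using (¬_)
open Counting using (module Setup)

proposition4p4 : (n r k : ℕ) → 1 ≤ n → 1 ≤ r → 1 ≤ k → k < r * n →
    (a : Vec ℤ n) → All (λ x → (ℤ.+ 1 ℤ.≤ x) × (x ℤ.≤ ℤ.+ (r * n ∸ k))) a →
    (p : ℕ) → 1 ≤ p → SameIncRearr a (shiftMod a (ℤ.+ p) (r * n ∸ k)) →
    (∀ (i : ℕ) → 1 ≤ i → i < p → ¬ SameIncRearr a (shiftMod a (ℤ.+ i) (r * n ∸ k))) →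
    Σ (List (Vec ℤ n)) λ L → Unique L × (∀ b → (b ∈ L) ⇔ Counted n r k a b) ×
      (length L * (r * n ∸ k) ≡ p * k)
proposition4p4 (suc n₀) r@(suc _) k _ _ _ k<rn a a∈[1,N] p 1≤p periodic minimal =
  Setup.WithPeriod.counted-list (r * suc n₀ ∸ k) r k n₀ (m∸n+n≡m (<⇒≤ k<rn)) a a∈[1,N] p periodic minimal
  where
  instance
    N≢0 : NonZero (r * suc n₀ ∸ k)
    N≢0 = >-nonZero (m<n⇒0<n∸m k<rn)
    p≢0 : NonZero p
    p≢0 = >-nonZero 1≤p
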